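{- Let $G$ be a map on an orientable surface of genus $g$, and let $\{B_1,\ldots,B_{2g}\}$ be a set of cycles of $G$, each with a direction of traversal, that forms a basis for the homology. An orientation of the primal-dual completion $\hat G$ of $G$ is a Schnyder orientation if and only if it is a $\bmod_3$-orientation such that $\gamma(B_i)\equiv 0 \pmod 3$ for all $1\le i\le 2g$.
   Context: A map is a graph embedded on an orientable surface so that every face is homeomorphic to an open disk; throughout, maps have no contractible cycles of length 1 or 2. An angle of $G$ is a face corner. An angle labeling is a map $\ell$ from the set of angles to $\mathbb{Z}_3$. Each edge $e$ has four incident angles (one on each side at each extremity). Edge $e$ is of type 0 if these four labels are all equal; of type 1 or 2 if in clockwise order they read $i-1,i,i,i+1$ for some $i$, type 1 if the two angles labeled $i$ are at the same extremity of $e$ and type 2 if they are on the same side of $e$. The labeling is EDGE if every edge is of type 0, 1 or 2. The primal-dual completion $\hat G$ is obtained by embedding $G$ and its dual $G^*$ simultaneously (each dual vertex inside its face, each edge crossing its dual edge exactly once) and making each crossing point a new vertex, called an edge-vertex; vertices of $G$ are primal-vertices, vertices of $G^*$ dual-vertices. Every edge of $\hat G$ joins an edge-vertex (of degree 4) to a primal- or dual-vertex, and each face of $\hat G$ is a quadrangle containing exactly one primal-vertex $v$ and one dual-vertex $f$, corresponding to the angle of $G$ at $v$ in face $f$. An orientation of $\hat G$ is a Schnyder orientation if there is an EDGE angle labeling $\ell$ of $G$ such that every edge of $\hat G$, which separates two faces of $\hat G$ corresponding to angles $a,a'$ of $G$, is oriented from its edge-vertex to its other end if $\ell(a)=\ell(a')$,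 and towards its edge-vertex if $\ell(a)\ne\ell(a')$. An orientation of $\hat G$ is a $\bmod_3$-orientation if every primal- and dual-vertex has outdegree $\equiv 0\pmod 3$ and every edge-vertex has outdegree $\equiv 1 \pmod 3$. For a cycle $C$ of $G$ with a direction of traversal, let $\hat C$ be the corresponding cycle of $\hat G$ (each edge subdivided by its edge-vertex); $\gamma(C)$ is the number of edges of $\hat G$ not in $\hat C$ that are oriented away from a vertex of $\hat C$ and lie on the right of $\hat C$, minus the number of such edges lying on the left of $\hat C$. Homology: fix an arbitrary reference orientation of the edges; a closed walk $W$ has characteristic flow $\phi(W)\in\mathbb{Z}^{E}$ ($\phi(W)_e$ = number of forward traversals minus backward traversals of $e$). Let $\mathbb{F}$ be the subgroup generated by the characteristic flows of the counterclockwise facial walks and $\mathbb{W}$ the subgroup generated by the characteristic flows of closed walks. A set of closed walks is a basis for the homology if their classes generate $\mathbb{W}/\mathbb{F}\cong\mathbb{Z}^{2g}$. -}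

module Defs where

open import Data.Nat as ℕ using (ℕ; zero; suc; _≤ᵇ_)
open import Data.Fin as Fin using (Fin; toℕ)
open import Data.Bool using (Bool; true; false; if_then_else_; not; _∧_; _∨_)
open import Data.List using (List; []; _∷_; _++_; [_]; length; allFin; upTo; zip)
open import Data.Bool.ListAction using (any; all)
open import Data.List.Relation.Unary.AllPairs using (AllPairs)
open import Data.Integer as ℤ using (ℤ; +_)
open import Data.Product using (Σ; _×_; _,_; ∃)
open import Data.Sum using (_⊎_; inj₁; inj₂)
open import Data.Unit using (⊤)
open import Relation.Nullary using (¬_)
open import Relation.Nullary.Decidable using (⌊_⌋)
open import Relation.Binary.PropositionalEquality using (_≡_; _≢_)
open import Relation.Binary.Construct.Closure.Equivalence using (EqClosure)
open import Function using (_∘_)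

iter : {A : Set} → (A → A) → ℕ → A → A
iter f zero x = x
iter f (suc k) x = f (iter f k x)

sumFin : (m : ℕ) → (Fin m → ℤ) → ℤ
sumFin zero f = + 0
sumFin (suc m) f = f Fin.zero ℤ.+ sumFin m (f ∘ Fin.suc)

countB : {A : Set} → (A → Bool) → List A → ℕ
countB p [] = 0
countB p (x ∷ xs) = if p x then suc (countB p xs) else countB p xs

-- ℤ_3 as Fin 3
next3 prev3 : Fin 3 → Fin 3
next3 Fin.zero = Fin.suc Fin.zero
next3 (Fin.suc Fin.zero) = Fin.suc (Fin.suc Fin.zero)
next3 (Fin.suc (Fin.suc Fin.zero)) = Fin.zero
prev3 Fin.zero = Fin.suc (Fin.suc Fin.zero)
prev3 (Fin.suc Fin.zero) = Fin.zero
prev3 (Fin.suc (Fin.suc Fin.zero)) = Fin.suc Fin.zero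

data Reach {n : ℕ} (σ σ⁻¹ α : Fin n → Fin n) (d : Fin n) : Fin n → Set where
  here  : Reach σ σ⁻¹ α d d
  stepσ : ∀ {e} → Reach σ σ⁻¹ α d e → Reach σ σ⁻¹ α d (σ e)
  stepσ⁻¹ : ∀ {e} → Reach σ σ⁻¹ α d e → Reach σ σ⁻¹ α d (σ⁻¹ e)
  stepα : ∀ {e} → Reach σ σ⁻¹ α d e → Reach σ σ⁻¹ α d (α e)

-- A map with n darts.  σ = counterclockwise rotation of darts around their
-- tail vertex, α = reversal of a dart.  Vertices = σ-orbits, edges =
-- α-orbits, faces = orbits of σ ∘ α (facial walks, face on the right).
record Map (n : ℕ) : Set where
  field
    σ σ⁻¹ α : Fin n → Fin n
    σσ⁻¹ : ∀ d → σ (σ⁻¹ d) ≡ d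
    σ⁻¹σ : ∀ d → σ⁻¹ (σ d) ≡ d
    αα : ∀ d → α (α d) ≡ d
    α-nofix : ∀ d → α d ≢ d
    connected : ∀ d d' → Reach σ σ⁻¹ α d d'

module MapDefs {n : ℕ} (M : Map n) where
  open Map M

  D : Set
  D = Fin n

  _==_ : D → D → Bool
  x == y = ⌊ x Fin.≟ y ⌋

  _==₃_ : Fin 3 → Fin 3 → Bool
  x ==₃ y = ⌊ x Fin.≟ y ⌋

  darts : List D
  darts = allFin n

  sameOrbit : (D → D) → D → D → Bool
  sameOrbit f d d' = any (λ k → iter f k d == d') (upTo n)

  isOrbitMin : (D → D) → D → Bool
  isOrbitMin f d = all (λ d' → not (sameOrbit f d d') ∨ (toℕ d ≤ᵇ toℕ d')) darts

  numOrbits : (D → D) → ℕ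
  numOrbits f = countB (isOrbitMin f) darts

  -- permutation of angles: angle d = corner at tail d between d and σ d;
  -- angles d, d' are in the same face iff same orbit of α ∘ σ
  faceOfAngle : D → D
  faceOfAngle = α ∘ σ

  numV numE numF : ℕ
  numV = numOrbits σ
  numE = numOrbits α
  numF = numOrbits (σ ∘ α)

  walkTo : (D → D) → ℕ → D → D → List D
  walkTo f zero x b = []
  walkTo f (suc k) x b = if x == b then [] else x ∷ walkTo f k (f x) b

  between : D → D → List D
  between a b = walkTo σ n (σ a) b

  faceWalk : D → List D
  faceWalk d = d ∷ walkTo (σ ∘ α) n (σ (α d)) d

  Labeling : Set
  Labeling = D → Fin 3

  Pat : Fin 3 → Fin 3 → Fin 3 → Fin 3 → Set
  Pat p q r s = q ≡ r × p ≡ prev3 q × s ≡ next3 q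

  -- the four angles around the edge of d, in clockwise order:
  -- tail-left, head-left, head-right, tail-right
  module _ (ℓ : Labeling) (d : D) where
    a1 a2 a3 a4 : Fin 3
    a1 = ℓ d
    a2 = ℓ (σ⁻¹ (α d))
    a3 = ℓ (α d)
    a4 = ℓ (σ⁻¹ d)

    Type0 Type1 Type2 : Set
    Type0 = a1 ≡ a2 × a2 ≡ a3 × a3 ≡ a4
    -- the two angles labelled i are at the same extremity
    Type1 = Pat a1 a2 a3 a4 ⊎ Pat a3 a4 a1 a2
    -- the two angles labelled i are on the same side
    Type2 = Pat a2 a3 a4 a1 ⊎ Pat a4 a1 a2 a3

  EDGE : Labeling → Set
  EDGE ℓ = ∀ d → Type0 ℓ d ⊎ Type1 ℓ d ⊎ Type2 ℓ d

  -- Its edges are indexed by D ⊎ D: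
  --  inj₁ d : edge-vertex of edge(d) — primal vertex tail d
  --           (separates angles d and σ⁻¹ d)
  --  inj₂ d : edge-vertex of edge(d) — dual vertex of the face on the left
  --           of d, i.e. the face containing angle d
  --           (separates angles d and σ⁻¹ (α d))
  -- An orientation assigns true iff the edge is oriented from its
  -- edge-vertex to its other end.
  Orientation : Set
  Orientation = D ⊎ D → Bool

  IsSchnyder : Orientation → Set
  IsSchnyder o = Σ Labeling λ ℓ → EDGE ℓ
    × (∀ d → o (inj₁ d) ≡ (ℓ d ==₃ ℓ (σ⁻¹ d)))
    × (∀ d → o (inj₂ d) ≡ (ℓ d ==₃ ℓ (σ⁻¹ (α d))))

  outPrimal outDual outEdge : Orientation → D → ℕ
  outPrimal o d = countB (λ x → sameOrbit σ d x ∧ not (o (inj₁ x))) darts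
  outDual o d = countB (λ x → sameOrbit faceOfAngle d x ∧ not (o (inj₂ x))) darts
  outEdge o d = countB o (inj₁ d ∷ inj₁ (α d) ∷ inj₂ d ∷ inj₂ (α d) ∷ [])

  IsMod3 : Orientation → Set
  IsMod3 o = ∀ d → (outPrimal o d ℕ.% 3 ≡ 0) × (outDual o d ℕ.% 3 ≡ 0)
                   × (outEdge o d ℕ.% 3 ≡ 1)

  Follows : D → D → Set
  Follows x y = sameOrbit σ (α x) y ≡ true     -- head x = tail y

  Chain : D → List D → D → Set
  Chain p [] first = Follows p first
  Chain p (y ∷ ys) first = Follows p y × Chain y ys first

  ClosedWalk : List D → Set
  ClosedWalk [] = ⊤
  ClosedWalk (x ∷ xs) = Chain x xs x

  DistinctVE : D → D → Set
  DistinctVE x y = (sameOrbit σ x y ≡ false) × (sameOrbit α x y ≡ false)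

  NonEmpty : List D → Set
  NonEmpty w = Σ D λ x → Σ (List D) λ xs → w ≡ x ∷ xs

  IsCycle : List D → Set
  IsCycle w = NonEmpty w × ClosedWalk w × AllPairs DistinctVE w

  lastOr : D → List D → D
  lastOr x [] = x
  lastOr x (y ∷ ys) = lastOr y ys

  cycPairs : List D → List (D × D)
  cycPairs [] = []
  cycPairs (x ∷ xs) = zip (lastOr x xs ∷ x ∷ xs) (x ∷ xs)

  b2z : Bool → ℤ
  b2z true = + 1
  b2z false = + 0

  -- contribution of the primal vertex tail c and the edge-vertex of c,
  -- where p is the previous dart: right minus left
  γstep : Orientation → D × D → ℤ
  γstep o (p , c) =
      (b2z (o (inj₂ (α c))) ℤ.- b2z (o (inj₂ c)))
    ℤ.+ (+ countB (λ x → not (o (inj₁ x))) (between (α p) c)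
         ℤ.- + countB (λ x → not (o (inj₁ x))) (between c (α p)))

  sumL : List ℤ → ℤ
  sumL [] = + 0
  sumL (z ∷ zs) = z ℤ.+ sumL zs

  mapL : {A B : Set} → (A → B) → List A → List B
  mapL f [] = []
  mapL f (x ∷ xs) = f x ∷ mapL f xs

  γ : Orientation → List D → ℤ
  γ o C = sumL (mapL (γstep o) (cycPairs C))

  -- Homology: flows as antisymmetric functions on darts
  flow : List D → D → ℤ
  flow w x = + countB (_== x) w ℤ.- + countB (_== α x) w

  faceFlow : D → D → ℤ
  faceFlow d x = b2z (sameOrbit (σ ∘ α) d x) ℤ.- b2z (sameOrbit (σ ∘ α) d (α x))

  IsHomologyBasis : (k : ℕ) → (Fin k → List D) → Set
  IsHomologyBasis k B = ∀ w → ClosedWalk w →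
    Σ (Fin k → ℤ) λ c → Σ (D → ℤ) λ b → ∀ x →
      flow w x ≡ sumFin k (λ i → c i ℤ.* flow (B i) x)
                 ℤ.+ sumFin n (λ d → b d ℤ.* faceFlow d x)

  -- Contractibility (free homotopy to a point, combinatorially)
  data HStep : List D → List D → Set where
    spur : ∀ u x w → HStep (u ++ x ∷ α x ∷ w) (u ++ w)
    face : ∀ u d w → HStep (u ++ faceWalk d ++ w) (u ++ w)
    rot  : ∀ x w → HStep (x ∷ w) (w ++ [ x ])

  Contractible : List D → Set
  Contractible w = EqClosure HStep w []

  NoShortContractibleCycles : Set
  NoShortContractibleCycles =
    ∀ w → IsCycle w → length w ℕ.≤ 2 → ¬ Contractible w

module Submission where

-- All computations happen in ℤ₃.  The jump of an edge of Ĝ is 0 if it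
-- leaves its edge-vertex and 1 otherwise.  Locally (EdgeLocal) a labeling
-- ℓ is EDGE and induces o iff every edge-vertex has outdegree ≡ 1 and ℓ
-- rises by the jump across every edge of Ĝ: the vertex rule
-- ℓ d = ℓ (σ⁻¹ d) + jumpV d and the face rule ℓ (σ⁻¹ (α d)) = ℓ d + jumpF d.
--  (⇒) Each rule makes the jumps a coboundary on the vertex, resp. face,
--      orbits, so primal and dual outdegrees are ≡ 0; and γ of a cycle is,
--      mod 3, twice the sum of the face defect of ℓ along it (γ-cycle),
--      which vanishes.
--  (⇐) Primal outdegrees ≡ 0 yield a potential ψ obeying the vertex rule
--      (discrete Poincaré lemma on orbits, OrbitSums.potential).  Its face
--      defect K is antisymmetric (edge-vertices), sums to 0 around faces
--      (dual vertices) and, by γ(Bᵢ) ≡ 0, along the basis; pairing with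
--      flows (Homology) then kills it on every closed walk, so it
--      integrates over the connected map to a vertex-constant t
--      (Integration), and ψ + t obeys both rules.

open import Defs
open import Data.Nat using (ℕ; zero; suc; _+_; _*_)
open import Data.Fin as Fin using (Fin)
open import Data.List using (List)
open import Data.Integer using (+_)
open import Data.Integer.Divisibility using (_∣_)
open import Data.Product using (_×_; _,_)
open import Function.Bundles using (_⇔_; mk⇔)
open import Relation.Binary.PropositionalEquality hiding ([_])

-- The field ℤ/3, represented by Fin 3 (next3 is "+1", prev3 is "-1").
-- Every identity between ℤ₃-valued operations in finitely many variables
-- is proved by evaluating both sides at all argument tuples
-- (check-sound below).
module ℤ₃ where

  open import Data.Fin using (_≟_)
  open import Data.Fin.Patterns using (0F; 1F; 2F)
  open import Data.Bool using (Bool; true; false; not; _∧_; _∨_; T)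
  open import Data.Empty using (⊥-elim)
  open import Relation.Nullary using (yes; no)
  open import Relation.Nullary.Decidable using (⌊_⌋)

  Z3 : Set
  Z3 = Fin 3

  infixl 7 _⊗_
  infixl 6 _⊕_ _⊝_
  infix 8 ⊝_

  _⊕_ : Z3 → Z3 → Z3
  0F ⊕ y = y
  1F ⊕ y = next3 y
  2F ⊕ y = prev3 y

  ⊝_ : Z3 → Z3
  ⊝ 0F = 0F
  ⊝ 1F = 2F
  ⊝ 2F = 1F

  _⊝_ : Z3 → Z3 → Z3
  x ⊝ y = x ⊕ ⊝ y

  _⊗_ : Z3 → Z3 → Z3
  0F ⊗ y = 0F
  1F ⊗ y = y
  2F ⊗ y = ⊝ y

  Op : ℕ → Set
  Op zero = Z3
  Op (suc k) = Z3 → Op k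

  zeros : ∀ k → Op k
  zeros zero = 0F
  zeros (suc k) = λ _ → zeros k

  Implies : ∀ k → Op k → Op k → Op k → Op k → Set
  Implies zero h₁ h₂ l r = h₁ ≡ h₂ → l ≡ r
  Implies (suc k) h₁ h₂ l r = ∀ x → Implies k (h₁ x) (h₂ x) (l x) (r x)

  check : ∀ k → Op k → Op k → Op k → Op k → Bool
  check zero h₁ h₂ l r = not ⌊ h₁ ≟ h₂ ⌋ ∨ ⌊ l ≟ r ⌋
  check (suc k) h₁ h₂ l r =
    check k (h₁ 0F) (h₂ 0F) (l 0F) (r 0F) ∧ check k (h₁ 1F) (h₂ 1F) (l 1F) (r 1F)
      ∧ check k (h₁ 2F) (h₂ 2F) (l 2F) (r 2F)

  pick : ∀ (f : Z3 → Bool) x → T (f 0F ∧ f 1F ∧ f 2F) → T (f x)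
  pick f 0F t with f 0F | f 1F | f 2F
  ... | true | true | true = _
  pick f 1F t with f 0F | f 1F | f 2F
  ... | true | true | true = _
  pick f 2F t with f 0F | f 1F | f 2F
  ... | true | true | true = _

  -- Soundness of the exhaustive check; the check itself is discharged by
  -- evaluation, so the implicit argument is solved automatically.
  check-sound : ∀ k h₁ h₂ l r → {T (check k h₁ h₂ l r)} → Implies k h₁ h₂ l r
  check-sound zero h₁ h₂ l r {c} e with h₁ ≟ h₂ | l ≟ r
  ... | _ | yes l≡r = l≡r
  ... | no h₁≢h₂ | no _ = ⊥-elim (h₁≢h₂ e)
  check-sound (suc k) h₁ h₂ l r {c} x =
    check-sound k (h₁ x) (h₂ x) (l x) (r x)
      {pick (λ y → check k (h₁ y) (h₂ y) (l y) (r y)) x c}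

  -- Unconditional identities: Implies with the trivial hypothesis 0 = 0.
  identity : ∀ k (l r : Op k) → {T (check k (zeros k) (zeros k) l r)} →
             Implies k (zeros k) (zeros k) l r
  identity k l r {c} = check-sound k (zeros k) (zeros k) l r {c}

  ⊕-assoc : ∀ x y z → x ⊕ y ⊕ z ≡ x ⊕ (y ⊕ z)
  ⊕-assoc x y z = identity 3 (λ x y z → x ⊕ y ⊕ z) (λ x y z → x ⊕ (y ⊕ z)) x y z refl

  ⊕-comm : ∀ x y → x ⊕ y ≡ y ⊕ x
  ⊕-comm x y = identity 2 _⊕_ (λ x y → y ⊕ x) x y refl

  ⊕-identityʳ : ∀ x → x ⊕ 0F ≡ x
  ⊕-identityʳ x = identity 1 (_⊕ 0F) (λ x → x) x refl

  ⊕-inverseʳ : ∀ x → x ⊝ x ≡ 0F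
  ⊕-inverseʳ x = identity 1 (λ x → x ⊝ x) (λ _ → 0F) x refl

  ⊝-involutive : ∀ x → ⊝ ⊝ x ≡ x
  ⊝-involutive x = identity 1 (λ x → ⊝ ⊝ x) (λ x → x) x refl

  ⊝-distrib-⊕ : ∀ x y → ⊝ (x ⊕ y) ≡ ⊝ x ⊕ ⊝ y
  ⊝-distrib-⊕ x y = identity 2 (λ x y → ⊝ (x ⊕ y)) (λ x y → ⊝ x ⊕ ⊝ y) x y refl

  ⊗-comm : ∀ x y → x ⊗ y ≡ y ⊗ x
  ⊗-comm x y = identity 2 _⊗_ (λ x y → y ⊗ x) x y refl

  ⊗-zeroʳ : ∀ x → x ⊗ 0F ≡ 0F
  ⊗-zeroʳ x = identity 1 (_⊗ 0F) (λ _ → 0F) x refl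

  ⊗-distribˡ : ∀ x y z → x ⊗ (y ⊕ z) ≡ x ⊗ y ⊕ x ⊗ z
  ⊗-distribˡ x y z = identity 3 (λ x y z → x ⊗ (y ⊕ z)) (λ x y z → x ⊗ y ⊕ x ⊗ z) x y z refl

  ⊗-distribʳ : ∀ x y z → (y ⊕ z) ⊗ x ≡ y ⊗ x ⊕ z ⊗ x
  ⊗-distribʳ x y z = identity 3 (λ x y z → (y ⊕ z) ⊗ x) (λ x y z → y ⊗ x ⊕ z ⊗ x) x y z refl

  ⊗-⊝ʳ : ∀ x y → x ⊗ ⊝ y ≡ ⊝ (x ⊗ y)
  ⊗-⊝ʳ x y = identity 2 (λ x y → x ⊗ ⊝ y) (λ x y → ⊝ (x ⊗ y)) x y refl

  ⊝≡⇒≡⊕ : ∀ x y z → x ⊝ y ≡ z → x ≡ y ⊕ z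
  ⊝≡⇒≡⊕ = check-sound 3 (λ x y _ → x ⊝ y) (λ _ _ z → z) (λ x _ _ → x) (λ _ y z → y ⊕ z)

  ≡⊕⇒⊝≡ : ∀ x y z → x ≡ y ⊕ z → x ⊝ y ≡ z
  ≡⊕⇒⊝≡ = check-sound 3 (λ x _ _ → x) (λ _ y z → y ⊕ z) (λ x y _ → x ⊝ y) (λ _ _ z → z)

  -- 2 is invertible in ℤ₃
  double≡0 : ∀ x → x ⊕ x ≡ 0F → x ≡ 0F
  double≡0 = check-sound 1 (λ x → x ⊕ x) (λ _ → 0F) (λ x → x) (λ _ → 0F)

  𝟙 : Bool → Z3
  𝟙 true = 1F
  𝟙 false = 0F

  𝟙-∧ : ∀ a b → 𝟙 (a ∧ b) ≡ 𝟙 a ⊗ 𝟙 b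
  𝟙-∧ true b = refl
  𝟙-∧ false b = refl

module Reduction where

  import Data.Nat as ℕ
  open import Data.Nat.Divisibility as ℕᵈ using (divides)
  open import Data.Integer as ℤ using (ℤ; +_; -[1+_]; _⊖_)
  open import Data.Integer.Properties using ([1+m]⊖[1+n]≡m⊖n)
  import Data.Integer.Divisibility as ℤᵈ
  open import Data.Sign as Sign using (Sign)
  open import Data.Fin.Patterns using (0F; 1F; 2F)
  open ≡-Reasoning
  open ℤ₃

  redℕ : ℕ → Z3
  redℕ zero = 0F
  redℕ (suc n) = 1F ⊕ redℕ n

  red : ℤ → Z3
  red (+ n) = redℕ n
  red -[1+ n ] = ⊝ redℕ (suc n)

  redℕ-+ : ∀ m n → redℕ (m ℕ.+ n) ≡ redℕ m ⊕ redℕ n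
  redℕ-+ zero n = refl
  redℕ-+ (suc m) n = trans (cong (1F ⊕_) (redℕ-+ m n)) (sym (⊕-assoc 1F (redℕ m) (redℕ n)))

  redℕ-* : ∀ m n → redℕ (m ℕ.* n) ≡ redℕ m ⊗ redℕ n
  redℕ-* zero n = refl
  redℕ-* (suc m) n = begin
    redℕ (n ℕ.+ m ℕ.* n)       ≡⟨ redℕ-+ n (m ℕ.* n) ⟩
    redℕ n ⊕ redℕ (m ℕ.* n)    ≡⟨ cong (redℕ n ⊕_) (redℕ-* m n) ⟩
    redℕ n ⊕ redℕ m ⊗ redℕ n   ≡⟨ identity 2 (λ a b → a ⊕ b ⊗ a) (λ a b → (1F ⊕ b) ⊗ a) (redℕ n) (redℕ m) refl ⟩
    (1F ⊕ redℕ m) ⊗ redℕ n     ∎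

  red-⊖ : ∀ m n → red (m ⊖ n) ≡ redℕ m ⊝ redℕ n
  red-⊖ zero zero = refl
  red-⊖ zero (suc n) = refl
  red-⊖ (suc m) zero = sym (⊕-identityʳ _)
  red-⊖ (suc m) (suc n) = begin
    red (suc m ⊖ suc n)   ≡⟨ cong red ([1+m]⊖[1+n]≡m⊖n m n) ⟩
    red (m ⊖ n)           ≡⟨ red-⊖ m n ⟩
    redℕ m ⊝ redℕ n       ≡⟨ identity 2 _⊝_ (λ a b → (1F ⊕ a) ⊝ (1F ⊕ b)) (redℕ m) (redℕ n) refl ⟩
    (1F ⊕ redℕ m) ⊝ (1F ⊕ redℕ n) ∎

  red-neg : ∀ z → red (ℤ.- z) ≡ ⊝ red z
  red-neg (+ zero) = refl
  red-neg (+ suc n) = refl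
  red-neg -[1+ n ] = sym (⊝-involutive _)

  red-+ : ∀ z w → red (z ℤ.+ w) ≡ red z ⊕ red w
  red-+ -[1+ m ] -[1+ n ] = begin
    ⊝ (1F ⊕ (1F ⊕ redℕ (m ℕ.+ n)))       ≡⟨ cong (λ t → ⊝ (1F ⊕ (1F ⊕ t))) (redℕ-+ m n) ⟩
    ⊝ (1F ⊕ (1F ⊕ (redℕ m ⊕ redℕ n)))    ≡⟨ identity 2 (λ a b → ⊝ (1F ⊕ (1F ⊕ (a ⊕ b)))) (λ a b → ⊝ (1F ⊕ a) ⊕ ⊝ (1F ⊕ b)) (redℕ m) (redℕ n) refl ⟩
    ⊝ (1F ⊕ redℕ m) ⊕ ⊝ (1F ⊕ redℕ n)    ∎
  red-+ -[1+ m ] (+ n) = trans (red-⊖ n (suc m)) (⊕-comm (redℕ n) (⊝ redℕ (suc m)))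
  red-+ (+ m) -[1+ n ] = red-⊖ m (suc n)
  red-+ (+ m) (+ n) = redℕ-+ m n

  red-- : ∀ z w → red (z ℤ.- w) ≡ red z ⊝ red w
  red-- z w = trans (red-+ z (ℤ.- w)) (cong (red z ⊕_) (red-neg w))

  sgn3 : Sign → Z3
  sgn3 Sign.+ = 1F
  sgn3 Sign.- = 2F

  red-◃ : ∀ s m → red (s ℤ.◃ m) ≡ sgn3 s ⊗ redℕ m
  red-◃ s zero = sym (⊗-zeroʳ (sgn3 s))
  red-◃ Sign.+ (suc m) = refl
  red-◃ Sign.- (suc m) = refl

  red-sign : ∀ z → red z ≡ sgn3 (ℤ.sign z) ⊗ redℕ ℤ.∣ z ∣
  red-sign (+ n) = refl
  red-sign -[1+ n ] = refl

  sgn3-* : ∀ s t → sgn3 (s Sign.* t) ≡ sgn3 s ⊗ sgn3 t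
  sgn3-* Sign.+ Sign.+ = refl
  sgn3-* Sign.+ Sign.- = refl
  sgn3-* Sign.- Sign.+ = refl
  sgn3-* Sign.- Sign.- = refl

  red-* : ∀ z w → red (z ℤ.* w) ≡ red z ⊗ red w
  red-* z w = begin
    red (z ℤ.* w)                      ≡⟨ red-◃ (ℤ.sign z Sign.* ℤ.sign w) (ℤ.∣ z ∣ ℕ.* ℤ.∣ w ∣) ⟩
    sgn3 (ℤ.sign z Sign.* ℤ.sign w) ⊗ redℕ (ℤ.∣ z ∣ ℕ.* ℤ.∣ w ∣)
                                       ≡⟨ cong₂ _⊗_ (sgn3-* (ℤ.sign z) (ℤ.sign w)) (redℕ-* ℤ.∣ z ∣ ℤ.∣ w ∣) ⟩
    sgn3 (ℤ.sign z) ⊗ sgn3 (ℤ.sign w) ⊗ (redℕ ℤ.∣ z ∣ ⊗ redℕ ℤ.∣ w ∣)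
                                       ≡⟨ identity 4 (λ a b c d → a ⊗ b ⊗ (c ⊗ d)) (λ a b c d → a ⊗ c ⊗ (b ⊗ d)) (sgn3 (ℤ.sign z)) (sgn3 (ℤ.sign w)) (redℕ ℤ.∣ z ∣) (redℕ ℤ.∣ w ∣) refl ⟩
    sgn3 (ℤ.sign z) ⊗ redℕ ℤ.∣ z ∣ ⊗ (sgn3 (ℤ.sign w) ⊗ redℕ ℤ.∣ w ∣)
                                       ≡⟨ sym (cong₂ _⊗_ (red-sign z) (red-sign w)) ⟩
    red z ⊗ red w                      ∎

  redℕ-periodic : ∀ k → redℕ (3 ℕ.+ k) ≡ redℕ k
  redℕ-periodic k = identity 1 (λ a → 1F ⊕ (1F ⊕ (1F ⊕ a))) (λ a → a) (redℕ k) refl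

  redℕ≡0⇒3∣ : ∀ k → redℕ k ≡ 0F → 3 ℕᵈ.∣ k
  redℕ≡0⇒3∣ zero e = divides 0 refl
  redℕ≡0⇒3∣ (suc zero) ()
  redℕ≡0⇒3∣ (suc (suc zero)) ()
  redℕ≡0⇒3∣ (suc (suc (suc k))) e with redℕ≡0⇒3∣ k (trans (sym (redℕ-periodic k)) e)
  ... | divides q eq = divides (suc q) (cong (3 ℕ.+_) eq)

  3∣⇒redℕ≡0 : ∀ k → 3 ℕᵈ.∣ k → redℕ k ≡ 0F
  3∣⇒redℕ≡0 k (divides q eq) = trans (cong redℕ eq) (trans (redℕ-* q 3) (⊗-zeroʳ (redℕ q)))

  %3≡0⇒redℕ≡0 : ∀ k → k ℕ.% 3 ≡ 0 → redℕ k ≡ 0F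
  %3≡0⇒redℕ≡0 k e = 3∣⇒redℕ≡0 k (ℕᵈ.m%n≡0⇒n∣m k 3 e)

  redℕ≡0⇒%3≡0 : ∀ k → redℕ k ≡ 0F → k ℕ.% 3 ≡ 0
  redℕ≡0⇒%3≡0 k e = ℕᵈ.n∣m⇒m%n≡0 k 3 (redℕ≡0⇒3∣ k e)

  red≡0⇒3∣ : ∀ z → red z ≡ 0F → (+ 3) ℤᵈ.∣ z
  red≡0⇒3∣ z e = redℕ≡0⇒3∣ ℤ.∣ z ∣ (cancel (ℤ.sign z) _ (trans (sym (red-sign z)) e))
    where
      cancel : ∀ s x → sgn3 s ⊗ x ≡ 0F → x ≡ 0F
      cancel Sign.+ x e = e
      cancel Sign.- x e = trans (sym (⊝-involutive x)) (cong ⊝_ e)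

  3∣⇒red≡0 : ∀ z → (+ 3) ℤᵈ.∣ z → red z ≡ 0F
  3∣⇒red≡0 z d = begin
    red z                                ≡⟨ red-sign z ⟩
    sgn3 (ℤ.sign z) ⊗ redℕ ℤ.∣ z ∣        ≡⟨ cong (sgn3 (ℤ.sign z) ⊗_) (3∣⇒redℕ≡0 ℤ.∣ z ∣ d) ⟩
    sgn3 (ℤ.sign z) ⊗ 0F                 ≡⟨ ⊗-zeroʳ (sgn3 (ℤ.sign z)) ⟩
    0F                                   ∎

module Sums where

  open import Data.Fin using (_≟_)
  open import Data.Fin.Patterns using (0F; 1F)
  import Data.Fin.Properties as Finₚ
  open import Data.Fin.Permutation using (permutation)
  open import Data.Bool using (Bool; true; false)
  open import Data.List using (List; []; _∷_; _++_; tabulate; allFin)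
  open import Data.Integer using (ℤ)
  open import Data.Empty using (⊥-elim)
  open import Function using (_∘_; id)
  open import Relation.Nullary using (yes; no)
  open import Relation.Nullary.Decidable using (⌊_⌋)
  open import Algebra.Bundles using (CommutativeMonoid)
  open ℤ₃
  open Reduction

  ⊕-commutativeMonoid : CommutativeMonoid _ _
  ⊕-commutativeMonoid = record
    { Carrier = Z3 ; _≈_ = _≡_ ; _∙_ = _⊕_ ; ε = 0F
    ; isCommutativeMonoid = record
      { isMonoid = record
        { isSemigroup = record
          { isMagma = record { isEquivalence = isEquivalence ; ∙-cong = cong₂ _⊕_ }
          ; assoc = ⊕-assoc }
        ; identity = (λ x → refl) , ⊕-identityʳ }
      ; comm = ⊕-comm } }

  open import Algebra.Properties.CommutativeMonoid.Sum ⊕-commutativeMonoid public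
    using (sum; ∑-comm; ∑-distrib-+; sum-cong-≗; sum-permute)

  sum-⊝ : ∀ {n} (f : Fin n → Z3) → sum (λ x → ⊝ f x) ≡ ⊝ sum f
  sum-⊝ {zero} f = refl
  sum-⊝ {suc n} f = trans (cong (⊝ f Fin.zero ⊕_) (sum-⊝ (f ∘ Fin.suc))) (sym (⊝-distrib-⊕ (f Fin.zero) _))

  sum-⊗ : ∀ {n} c (f : Fin n → Z3) → sum (λ x → c ⊗ f x) ≡ c ⊗ sum f
  sum-⊗ {zero} c f = sym (⊗-zeroʳ c)
  sum-⊗ {suc n} c f = trans (cong (c ⊗ f Fin.zero ⊕_) (sum-⊗ c (f ∘ Fin.suc))) (sym (⊗-distribˡ c (f Fin.zero) _))

  sum-zero : ∀ {n} (f : Fin n → Z3) → (∀ x → f x ≡ 0F) → sum f ≡ 0F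
  sum-zero {zero} f e = refl
  sum-zero {suc n} f e = cong₂ _⊕_ (e Fin.zero) (sum-zero (f ∘ Fin.suc) (e ∘ Fin.suc))

  sum-reindex : ∀ {n} (π ρ : Fin n → Fin n) → (∀ x → π (ρ x) ≡ x) → (∀ x → ρ (π x) ≡ x) →
    (h : Fin n → Z3) → sum h ≡ sum (h ∘ π)
  sum-reindex π ρ πρ ρπ h = sum-permute h (permutation π ρ πρ ρπ)

  _==_ : ∀ {n} → Fin n → Fin n → Bool
  x == y = ⌊ x ≟ y ⌋

  suc==suc : ∀ {n} (a b : Fin n) → ⌊ Fin.suc a ≟ Fin.suc b ⌋ ≡ ⌊ a ≟ b ⌋
  suc==suc a b with a ≟ b | Fin.suc a ≟ Fin.suc b
  ... | yes _ | yes _ = refl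
  ... | no _ | no _ = refl
  ... | yes a≡b | no sa≢sb = ⊥-elim (sa≢sb (cong Fin.suc a≡b))
  ... | no a≢b | yes sa≡sb = ⊥-elim (a≢b (Finₚ.suc-injective sa≡sb))

  sum-indicator : ∀ {n} (y : Fin n) (h : Fin n → Z3) → sum (λ x → 𝟙 (y == x) ⊗ h x) ≡ h y
  sum-indicator {suc n} Fin.zero h =
    trans (cong (h Fin.zero ⊕_) (sum-zero (λ x → 𝟙 (Fin.zero == Fin.suc x) ⊗ h (Fin.suc x)) (λ x → refl)))
          (⊕-identityʳ (h Fin.zero))
  sum-indicator {suc n} (Fin.suc y) h =
    trans (sum-cong-≗ (λ x → cong (λ t → 𝟙 t ⊗ h (Fin.suc x)) (suc==suc y x)))
          (sum-indicator y (h ∘ Fin.suc))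

  ΣL : {A : Set} → (A → Z3) → List A → Z3
  ΣL h [] = 0F
  ΣL h (x ∷ xs) = h x ⊕ ΣL h xs

  ΣL-⊕ : ∀ {A : Set} (f g : A → Z3) xs → ΣL (λ x → f x ⊕ g x) xs ≡ ΣL f xs ⊕ ΣL g xs
  ΣL-⊕ f g [] = refl
  ΣL-⊕ f g (x ∷ xs) = trans (cong (f x ⊕ g x ⊕_) (ΣL-⊕ f g xs))
    (identity 4 (λ a b c d → a ⊕ b ⊕ (c ⊕ d)) (λ a b c d → a ⊕ c ⊕ (b ⊕ d)) (f x) (g x) (ΣL f xs) (ΣL g xs) refl)

  ΣL-cong : ∀ {A : Set} {f g : A → Z3} xs → (∀ x → f x ≡ g x) → ΣL f xs ≡ ΣL g xs
  ΣL-cong [] e = refl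
  ΣL-cong (x ∷ xs) e = cong₂ _⊕_ (e x) (ΣL-cong xs e)

  ΣL-++ : ∀ {A : Set} (f : A → Z3) xs ys → ΣL f (xs ++ ys) ≡ ΣL f xs ⊕ ΣL f ys
  ΣL-++ f [] ys = refl
  ΣL-++ f (x ∷ xs) ys = trans (cong (f x ⊕_) (ΣL-++ f xs ys)) (sym (⊕-assoc (f x) _ _))

  ΣL-zero : ∀ {A : Set} (f : A → Z3) xs → (∀ x → f x ≡ 0F) → ΣL f xs ≡ 0F
  ΣL-zero f [] h = refl
  ΣL-zero f (x ∷ xs) h = cong₂ _⊕_ (h x) (ΣL-zero f xs h)

  ΣL-tabulate : ∀ {A : Set} {n} (h : A → Z3) (f : Fin n → A) → ΣL h (tabulate f) ≡ sum (h ∘ f)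
  ΣL-tabulate {n = zero} h f = refl
  ΣL-tabulate {n = suc n} h f = cong (h (f Fin.zero) ⊕_) (ΣL-tabulate h (f ∘ Fin.suc))

  redℕ-countB : ∀ {A : Set} (P : A → Bool) xs → redℕ (countB P xs) ≡ ΣL (𝟙 ∘ P) xs
  redℕ-countB P [] = refl
  redℕ-countB P (x ∷ xs) with P x
  ... | true = cong (1F ⊕_) (redℕ-countB P xs)
  ... | false = redℕ-countB P xs

  redℕ-countB-allFin : ∀ {n} (P : Fin n → Bool) → redℕ (countB P (allFin n)) ≡ sum (𝟙 ∘ P)
  redℕ-countB-allFin {n} P = trans (redℕ-countB P (allFin n)) (ΣL-tabulate (𝟙 ∘ P) id)

  red-sumFin : ∀ m (f : Fin m → ℤ) → red (sumFin m f) ≡ sum (red ∘ f)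
  red-sumFin zero f = refl
  red-sumFin (suc m) f = trans (red-+ (f Fin.zero) _) (cong (red (f Fin.zero) ⊕_) (red-sumFin m (f ∘ Fin.suc)))

-- SameOrbit is the
-- Boolean relation "y = fᵏ x for some k < n", literally the relation
-- sameOrbit of Defs; we show it is the orbit equivalence relation.
module Orbit {n : ℕ} (f g : Fin n → Fin n) (fg : ∀ x → f (g x) ≡ x) (gf : ∀ x → g (f x) ≡ x) where

  open import Data.Nat using (_∸_; _≤_; _<_; NonZero; >-nonZero)
  open import Data.Nat.Properties as ℕₚ using (n<1+n; m<n⇒0<n∸m; m∸n≤m; ≤-pred; m+[n∸m]≡n; m∸n+n≡m)
  open import Data.Nat.DivMod using (_%_; _/_; m≡m%n+[m/n]*n; m%n<n)
  open import Data.Fin using (toℕ; _≟_)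
  open import Data.Fin.Properties using (pigeonhole; toℕ<n)
  open import Data.Bool using (Bool; true)
  open import Data.Bool.Properties using (T-≡; ⇔→≡)
  open import Data.Bool.ListAction using (any)
  open import Data.List using (upTo)
  open import Data.List.Relation.Unary.Any.Properties using (any⁺; any⁻; applyUpTo⁺; applyUpTo⁻)
  open import Data.Product using (Σ)
  open import Function using (id; mk⇔; Equivalence)
  open import Relation.Nullary.Decidable using (⌊_⌋; toWitness; fromWitness)
  open Equivalence using (to; from)

  SameOrbit : Fin n → Fin n → Bool
  SameOrbit x y = any (λ k → ⌊ iter f k x ≟ y ⌋) (upTo n)

  f-injective : ∀ {x y} → f x ≡ f y → x ≡ y
  f-injective {x} {y} e = trans (sym (gf x)) (trans (cong g e) (gf y))

  iter-+ : ∀ a b x → iter f (a + b) x ≡ iter f a (iter f b x)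
  iter-+ zero b x = refl
  iter-+ (suc a) b x = cong f (iter-+ a b x)

  iter-suc : ∀ k x → iter f (suc k) x ≡ iter f k (f x)
  iter-suc k x = trans (cong (λ t → iter f t x) (ℕₚ.+-comm 1 k)) (iter-+ k 1 x)

  iter-injective : ∀ k {x y} → iter f k x ≡ iter f k y → x ≡ y
  iter-injective zero e = e
  iter-injective (suc k) e = iter-injective k (f-injective e)

  period : ∀ x → Σ ℕ λ p → 0 < p × p ≤ n × iter f p x ≡ x
  period x with pigeonhole (n<1+n n) (λ (i : Fin (suc n)) → iter f (toℕ i) x)
  ... | i , j , i<j , e = toℕ j ∸ toℕ i , m<n⇒0<n∸m i<j , ℕₚ.≤-trans (m∸n≤m (toℕ j) (toℕ i)) (≤-pred (toℕ<n j)) ,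
        iter-injective (toℕ i) (begin
          iter f (toℕ i) (iter f (toℕ j ∸ toℕ i) x) ≡⟨ sym (iter-+ (toℕ i) (toℕ j ∸ toℕ i) x) ⟩
          iter f (toℕ i + (toℕ j ∸ toℕ i)) x         ≡⟨ cong (λ t → iter f t x) (m+[n∸m]≡n (ℕₚ.<⇒≤ i<j)) ⟩
          iter f (toℕ j) x                           ≡⟨ sym e ⟩
          iter f (toℕ i) x                           ∎)
    where open ≡-Reasoning

  iter-multiple : ∀ x p → iter f p x ≡ x → ∀ q → iter f (q * p) x ≡ x
  iter-multiple x p e zero = refl
  iter-multiple x p e (suc q) = trans (iter-+ p (q * p) x) (trans (cong (iter f p) (iter-multiple x p e q)) e)

  iter-mod : ∀ x p .{{_ : NonZero p}} → iter f p x ≡ x → ∀ k → iter f k x ≡ iter f (k % p) x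
  iter-mod x p e k = begin
    iter f k x                                   ≡⟨ cong (λ t → iter f t x) (m≡m%n+[m/n]*n k p) ⟩
    iter f (k % p + (k / p) * p) x               ≡⟨ iter-+ (k % p) ((k / p) * p) x ⟩
    iter f (k % p) (iter f ((k / p) * p) x)      ≡⟨ cong (iter f (k % p)) (iter-multiple x p e (k / p)) ⟩
    iter f (k % p) x                             ∎
    where open ≡-Reasoning

  SO-intro< : ∀ k x y → k < n → iter f k x ≡ y → SameOrbit x y ≡ true
  SO-intro< k x y k<n e = to T-≡ (any⁺ _ (applyUpTo⁺ id (fromWitness e) k<n))

  SO-elim : ∀ x y → SameOrbit x y ≡ true → Σ ℕ λ k → k < n × iter f k x ≡ y
  SO-elim x y e with applyUpTo⁻ id (any⁻ _ (upTo n) (from T-≡ e))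
  ... | k , k<n , t = k , k<n , toWitness t

  -- any number of steps is allowed, by reducing it modulo a period
  SO-intro : ∀ k x y → iter f k x ≡ y → SameOrbit x y ≡ true
  SO-intro k x y e with period x
  ... | p , p>0 , p≤n , pe = SO-intro< (k % p) x y (ℕₚ.<-≤-trans (m%n<n k p) p≤n)
                               (trans (sym (iter-mod x p pe k)) e)
    where instance _ = >-nonZero p>0

  SO-refl : ∀ x → SameOrbit x x ≡ true
  SO-refl x = SO-intro 0 x x refl

  SO-sym : ∀ x y → SameOrbit x y ≡ true → SameOrbit y x ≡ true
  SO-sym x y xy with SO-elim x y xy | period x
  ... | k , _ , e | p , p>0 , _ , pe = SO-intro (p ∸ k % p) y x (begin
      iter f (p ∸ k % p) y                     ≡⟨ cong (iter f (p ∸ k % p)) (trans (sym e) (iter-mod x p pe k)) ⟩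
      iter f (p ∸ k % p) (iter f (k % p) x)     ≡⟨ sym (iter-+ (p ∸ k % p) (k % p) x) ⟩
      iter f (p ∸ k % p + k % p) x             ≡⟨ cong (λ t → iter f t x) (m∸n+n≡m (ℕₚ.<⇒≤ (m%n<n k p))) ⟩
      iter f p x                               ≡⟨ pe ⟩
      x                                        ∎)
    where
      open ≡-Reasoning
      instance _ = >-nonZero p>0

  SO-trans : ∀ x y z → SameOrbit x y ≡ true → SameOrbit y z ≡ true → SameOrbit x z ≡ true
  SO-trans x y z xy yz with SO-elim x y xy | SO-elim y z yz
  ... | k₁ , _ , e₁ | k₂ , _ , e₂ = SO-intro (k₂ + k₁) x z (trans (iter-+ k₂ k₁ x) (trans (cong (iter f k₂) e₁) e₂))

  SO-step : ∀ x → SameOrbit x (f x) ≡ true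
  SO-step x = SO-intro 1 x (f x) refl

  SO-congʳ : ∀ x y z → SameOrbit y z ≡ true → SameOrbit x y ≡ SameOrbit x z
  SO-congʳ x y z yz = ⇔→≡ {z = true} (mk⇔ (λ xy → SO-trans x y z xy yz)
                                          (λ xz → SO-trans x z y xz (SO-sym y z yz)))

  SO-f : ∀ d x → SameOrbit d (f x) ≡ SameOrbit d x
  SO-f d x = SO-congʳ d (f x) x (SO-sym x (f x) (SO-step x))

  SO-g : ∀ d x → SameOrbit d (g x) ≡ SameOrbit d x
  SO-g d x = trans (sym (SO-f d (g x))) (cong (SameOrbit d) (fg x))

module FirstIndex where

  open import Data.Nat using (_<_; s≤s)
  open import Data.Fin using (toℕ)
  open import Data.Bool using (Bool; true; false; if_then_else_)
  open import Data.Maybe as Maybe using (Maybe; just; nothing)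
  open import Data.Product using (Σ)
  open import Function using (_∘_)

  first : ∀ {n} → (Fin n → Bool) → Maybe (Fin n)
  first {zero} P = nothing
  first {suc n} P = if P Fin.zero then just Fin.zero else Maybe.map Fin.suc (first (P ∘ Fin.suc))

  first-cong : ∀ {n} (P Q : Fin n → Bool) → (∀ x → P x ≡ Q x) → first P ≡ first Q
  first-cong {zero} P Q e = refl
  first-cong {suc n} P Q e rewrite e Fin.zero | first-cong (P ∘ Fin.suc) (Q ∘ Fin.suc) (e ∘ Fin.suc) = refl

  first-found : ∀ {n} (P : Fin n → Bool) x → P x ≡ true → Σ (Fin n) λ y → first P ≡ just y × P y ≡ true
  first-found {suc n} P x px with P Fin.zero in e0
  ... | true = Fin.zero , refl , e0
  first-found {suc n} P Fin.zero px | false with () ← trans (sym e0) px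
  first-found {suc n} P (Fin.suc x) px | false with first-found (P ∘ Fin.suc) x px
  ... | y , fy , py rewrite fy = Fin.suc y , refl , py

  first-least : ∀ {n} (P : Fin n → Bool) y → first P ≡ just y → ∀ z → toℕ z < toℕ y → P z ≡ false
  first-least {suc n} P y fe z lt with P Fin.zero in e0
  first-least {suc n} P Fin.zero refl z () | true
  first-least {suc n} P y fe z lt | false with first (P ∘ Fin.suc) in e1
  first-least {suc n} P y () z lt | false | nothing
  first-least {suc n} P .(Fin.suc y') refl Fin.zero lt | false | just y' = e0
  first-least {suc n} P .(Fin.suc y') refl (Fin.suc z) (s≤s lt) | false | just y' =
    first-least (P ∘ Fin.suc) y' e1 z lt

module OrbitSums {n : ℕ} (f g : Fin n → Fin n) (fg : ∀ x → f (g x) ≡ x) (gf : ∀ x → g (f x) ≡ x) where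

  open import Data.Nat as ℕ using (_≤_; _<_; s≤s)
  import Data.Nat.Properties as ℕₚ
  open import Data.Fin using (toℕ; _≟_; fromℕ<)
  open import Data.Fin.Properties using (toℕ<n; toℕ-fromℕ<)
  open import Data.Fin.Patterns using (0F)
  open import Data.Bool using (Bool; true; false)
  open import Data.Maybe using (just; fromMaybe)
  open import Data.Product using (Σ; proj₁; proj₂)
  open import Data.Empty using (⊥-elim)
  open import Relation.Nullary using (yes; no; ¬_)
  open import Relation.Nullary.Decidable using (⌊_⌋; toWitness; fromWitness)
  open import Data.Bool.Properties using (T-≡)
  open import Function using (Equivalence)
  open Equivalence using (to; from)
  open ≡-Reasoning
  open ℤ₃
  open Sums
  open Orbit f g fg gf
  open FirstIndex

  orbitSum : (Fin n → Z3) → Fin n → Z3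
  orbitSum h d = sum (λ x → 𝟙 (SameOrbit d x) ⊗ h x)

  orbitSum-cong : ∀ {h h'} → (∀ x → h x ≡ h' x) → ∀ d → orbitSum h d ≡ orbitSum h' d
  orbitSum-cong e d = sum-cong-≗ (λ x → cong (𝟙 (SameOrbit d x) ⊗_) (e x))

  orbitSum-⊕ : ∀ h h' d → orbitSum (λ x → h x ⊕ h' x) d ≡ orbitSum h d ⊕ orbitSum h' d
  orbitSum-⊕ h h' d = trans (sum-cong-≗ (λ x → ⊗-distribˡ (𝟙 (SameOrbit d x)) (h x) (h' x)))
                            (∑-distrib-+ (λ x → 𝟙 (SameOrbit d x) ⊗ h x) _)

  orbitSum-⊝ : ∀ h d → orbitSum (λ x → ⊝ h x) d ≡ ⊝ orbitSum h d
  orbitSum-⊝ h d = trans (sum-cong-≗ (λ x → ⊗-⊝ʳ (𝟙 (SameOrbit d x)) (h x)))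
                         (sum-⊝ (λ x → 𝟙 (SameOrbit d x) ⊗ h x))

  -- g permutes each orbit
  orbitSum-∘g : ∀ h d → orbitSum (λ x → h (g x)) d ≡ orbitSum h d
  orbitSum-∘g h d = trans (sum-cong-≗ (λ x → cong (λ t → 𝟙 t ⊗ h (g x)) (sym (SO-g d x))))
                          (sym (sum-reindex g f gf fg (λ y → 𝟙 (SameOrbit d y) ⊗ h y)))

  orbitSum-coboundary : ∀ φ d → orbitSum (λ x → φ x ⊝ φ (g x)) d ≡ 0F
  orbitSum-coboundary φ d = begin
    orbitSum (λ x → φ x ⊝ φ (g x)) d              ≡⟨ orbitSum-⊕ φ (λ x → ⊝ φ (g x)) d ⟩
    orbitSum φ d ⊕ orbitSum (λ x → ⊝ φ (g x)) d   ≡⟨ cong (orbitSum φ d ⊕_) (orbitSum-⊝ (λ x → φ (g x)) d) ⟩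
    orbitSum φ d ⊝ orbitSum (λ x → φ (g x)) d     ≡⟨ cong (λ t → orbitSum φ d ⊝ t) (orbitSum-∘g φ d) ⟩
    orbitSum φ d ⊝ orbitSum φ d                   ≡⟨ ⊕-inverseʳ (orbitSum φ d) ⟩
    0F                                            ∎

  root : Fin n → Fin n
  root d = fromMaybe d (first (λ x → SameOrbit x d))

  root-spec : ∀ d → first (λ x → SameOrbit x d) ≡ just (root d) × SameOrbit (root d) d ≡ true
  root-spec d with first-found (λ x → SameOrbit x d) d (SO-refl d)
  ... | y , fy , py rewrite fy = refl , py

  root-cong : ∀ d e → SameOrbit d e ≡ true → root d ≡ root e
  root-cong d e de = cong (fromMaybe d) (trans (first-cong _ _ (λ x → SO-congʳ x d e de)) (proj₁ (root-spec e)))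

  root-g : ∀ d → root (g d) ≡ root d
  root-g d = sym (root-cong d (g d) (trans (SO-g d d) (SO-refl d)))

  depthP : Fin n → Fin n → Bool
  depthP d k = ⌊ iter f (toℕ k) (root d) ≟ d ⌋

  depthP-intro : ∀ d j (j<n : j < n) → iter f j (root d) ≡ d → depthP d (fromℕ< j<n) ≡ true
  depthP-intro d j j<n e = to T-≡ (fromWitness (trans (cong (λ t → iter f t (root d)) (toℕ-fromℕ< j<n)) e))

  -- (opaque: only the specification of the search is ever needed)
  opaque
    depth-found : ∀ d → Σ (Fin n) λ k → first (depthP d) ≡ just k × depthP d k ≡ true
    depth-found d with SO-elim (root d) d (proj₂ (root-spec d))
    ... | k , k<n , e = first-found (depthP d) (fromℕ< k<n) (depthP-intro d k k<n e)

  depth : Fin n → ℕ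
  depth d = toℕ (proj₁ (depth-found d))

  depth-spec : ∀ d → iter f (depth d) (root d) ≡ d
  depth-spec d = toWitness (from T-≡ (proj₂ (proj₂ (depth-found d))))

  depth-least : ∀ d j → iter f j (root d) ≡ d → depth d ≤ j
  depth-least d j e with j ℕ.<? n
  ... | no j≮n = ℕₚ.<⇒≤ (ℕₚ.<-≤-trans (toℕ<n (proj₁ (depth-found d))) (ℕₚ.≮⇒≥ j≮n))
  ... | yes j<n = ℕₚ.≮⇒≥ not-below
    where
      not-below : ¬ (j < depth d)
      not-below j<depth with () ← trans (sym (first-least (depthP d) (proj₁ (depth-found d)) (proj₁ (proj₂ (depth-found d)))
                                          (fromℕ< j<n) (subst (_< depth d) (sym (toℕ-fromℕ< j<n)) j<depth)))
                                       (depthP-intro d j j<n e)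

  iter-depth-g : ∀ d → iter f (suc (depth (g d))) (root d) ≡ d
  iter-depth-g d = begin
    f (iter f (depth (g d)) (root d))       ≡⟨ cong (λ r → f (iter f (depth (g d)) r)) (sym (root-g d)) ⟩
    f (iter f (depth (g d)) (root (g d)))   ≡⟨ cong f (depth-spec (g d)) ⟩
    f (g d)                                 ≡⟨ fg d ⟩
    d                                       ∎

  depth-g : ∀ d → d ≢ root d → depth d ≡ suc (depth (g d))
  depth-g d d≢r = ℕₚ.≤-antisym (depth-least d (suc (depth (g d))) (iter-depth-g d)) lower
    where
      lower : suc (depth (g d)) ≤ depth d
      lower with depth d | depth-spec d
      ... | zero | e = ⊥-elim (d≢r (sym e))
      ... | suc k | e = s≤s (depth-least (g d) k
                          (trans (cong (iter f k) (root-g d)) (f-injective (trans e (sym (fg d))))))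

  -- candidate potential: sum of h along the orbit from the root to d
  module Integrate (h : Fin n → Z3) where

    partialSum : Fin n → ℕ → Z3
    partialSum r zero = 0F
    partialSum r (suc k) = partialSum r k ⊕ h (iter f (suc k) r)

    ψ : Fin n → Z3
    ψ d = partialSum (root d) (depth d)

    ψ-step : ∀ d → d ≢ root d → ψ d ≡ ψ (g d) ⊕ h d
    ψ-step d d≢r = begin
      partialSum (root d) (depth d)
        ≡⟨ cong (partialSum (root d)) (depth-g d d≢r) ⟩
      partialSum (root d) (depth (g d)) ⊕ h (iter f (suc (depth (g d))) (root d))
        ≡⟨ cong₂ (λ r y → partialSum r (depth (g d)) ⊕ h y) (sym (root-g d)) (iter-depth-g d) ⟩
      ψ (g d) ⊕ h d
        ∎

    -- failure of the potential equation; it can only occur at roots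
    defect : Fin n → Z3
    defect x = ψ x ⊝ (ψ (g x) ⊕ h x)

    defect-off-root : ∀ x → x ≢ root x → defect x ≡ 0F
    defect-off-root x x≢r = trans (cong (_⊝ (ψ (g x) ⊕ h x)) (ψ-step x x≢r)) (⊕-inverseʳ (ψ (g x) ⊕ h x))

    -- the orbit of d contains exactly one root
    defect-orbitSum : ∀ d → orbitSum defect d ≡ defect (root d)
    defect-orbitSum d = trans (sum-cong-≗ only-root) (sum-indicator (root d) defect)
      where
        only-root : ∀ x → 𝟙 (SameOrbit d x) ⊗ defect x ≡ 𝟙 ⌊ root d ≟ x ⌋ ⊗ defect x
        only-root x with root d ≟ x
        ... | yes refl = cong (λ b → 𝟙 b ⊗ defect (root d)) (SO-sym (root d) d (proj₂ (root-spec d)))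
        ... | no r≢x with SameOrbit d x in dx
        ...   | false = refl
        ...   | true = defect-off-root x (λ x≡rx → r≢x (trans (root-cong d x dx) (sym x≡rx)))

    module _ (zero-sums : ∀ d → orbitSum h d ≡ 0F) where

      -- if h sums to zero over orbits, so does the defect, hence it vanishes
      defect-orbitSum≡0 : ∀ d → orbitSum defect d ≡ 0F
      defect-orbitSum≡0 d = begin
        orbitSum defect d
          ≡⟨ orbitSum-cong (λ x → identity 3 (λ a b c → a ⊝ (b ⊕ c)) (λ a b c → a ⊝ b ⊕ ⊝ c) (ψ x) (ψ (g x)) (h x) refl) d ⟩
        orbitSum (λ x → ψ x ⊝ ψ (g x) ⊕ ⊝ h x) d
          ≡⟨ orbitSum-⊕ (λ x → ψ x ⊝ ψ (g x)) (λ x → ⊝ h x) d ⟩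
        orbitSum (λ x → ψ x ⊝ ψ (g x)) d ⊕ orbitSum (λ x → ⊝ h x) d
          ≡⟨ cong₂ _⊕_ (orbitSum-coboundary ψ d) (trans (orbitSum-⊝ h d) (cong ⊝_ (zero-sums d))) ⟩
        0F
          ∎

      ψ-potential : ∀ x → ψ x ≡ ψ (g x) ⊕ h x
      ψ-potential x = trans (⊝≡⇒≡⊕ (ψ x) (ψ (g x) ⊕ h x) 0F no-defect) (⊕-identityʳ _)
        where
          no-defect : defect x ≡ 0F
          no-defect with x ≟ root x
          ... | no x≢r = defect-off-root x x≢r
          ... | yes x≡r = trans (cong defect x≡r) (trans (sym (defect-orbitSum x)) (defect-orbitSum≡0 x))

  potential : (h : Fin n → Z3) → (∀ d → orbitSum h d ≡ 0F) →
              Σ (Fin n → Z3) λ ψ → ∀ x → ψ x ≡ ψ (g x) ⊕ h x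
  potential h zero-sums = Integrate.ψ h , Integrate.ψ-potential h zero-sums

-- Its four angles, clockwise, carry
-- labels a₁ a₂ a₃ a₄; crossing one of the four edges of Ĝ at its
-- edge-vertex raises the label by the jump of that edge: 0 if the edge
-- points away from the edge-vertex (equal labels), 1 otherwise.  The four
-- edges are v (between a₄,a₁), f (a₁,a₂), v' (a₂,a₃) and f' (a₃,a₄).
module EdgeLocal where

  import Data.Nat as ℕ
  open import Data.Fin using (_≟_)
  open import Data.Fin.Patterns using (0F; 1F; 2F)
  open import Data.Bool using (Bool; true; false; not)
  open import Data.List using ([]; _∷_)
  open import Data.Sum using (_⊎_; inj₁; inj₂)
  open import Function using (id)
  open import Relation.Nullary.Decidable using (⌊_⌋)
  open ℤ₃

  _==₃_ : Z3 → Z3 → Bool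
  x ==₃ y = ⌊ x ≟ y ⌋

  jump : Bool → Z3
  jump o = 𝟙 (not o)

  -- the number of edges of Ĝ leaving the edge-vertex
  outCount : Bool → Bool → Bool → Bool → ℕ
  outCount v v' f f' = countB id (v ∷ v' ∷ f ∷ f' ∷ [])

  Pattern : Z3 → Z3 → Z3 → Z3 → Set
  Pattern p q r s = q ≡ r × p ≡ prev3 q × s ≡ next3 q

  EdgeType : Z3 → Z3 → Z3 → Z3 → Set
  EdgeType a₁ a₂ a₃ a₄ = (a₁ ≡ a₂ × a₂ ≡ a₃ × a₃ ≡ a₄)
    ⊎ (Pattern a₁ a₂ a₃ a₄ ⊎ Pattern a₃ a₄ a₁ a₂) ⊎ (Pattern a₂ a₃ a₄ a₁ ⊎ Pattern a₄ a₁ a₂ a₃)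

  jump-equal₁ : ∀ b o → ((b ⊕ jump o) ==₃ b) ≡ o
  jump-equal₁ 0F true = refl
  jump-equal₁ 0F false = refl
  jump-equal₁ 1F true = refl
  jump-equal₁ 1F false = refl
  jump-equal₁ 2F true = refl
  jump-equal₁ 2F false = refl

  jump-equal₂ : ∀ a o → (a ==₃ (a ⊕ jump o)) ≡ o
  jump-equal₂ 0F true = refl
  jump-equal₂ 0F false = refl
  jump-equal₂ 1F true = refl
  jump-equal₂ 1F false = refl
  jump-equal₂ 2F true = refl
  jump-equal₂ 2F false = refl

  -- outdegree ≡ 1 (mod 3) means one or all four edges leave the
  -- edge-vertex; either way the jumps around the edge-vertex cancel
  jumps-cancel : ∀ v v' f f' → outCount v v' f f' ℕ.% 3 ≡ 1 →
                 jump v ⊕ jump f ⊕ jump v' ⊕ jump f' ≡ 0F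
  jumps-cancel true  true  true  true  _ = refl
  jumps-cancel true  false false false _ = refl
  jumps-cancel false true  false false _ = refl
  jumps-cancel false false true  false _ = refl
  jumps-cancel false false false true  _ = refl
  jumps-cancel true  true  true  false ()
  jumps-cancel true  true  false true  ()
  jumps-cancel true  true  false false ()
  jumps-cancel true  false true  true  ()
  jumps-cancel true  false true  false ()
  jumps-cancel true  false false true  ()
  jumps-cancel false true  true  true  ()
  jumps-cancel false true  true  false ()
  jumps-cancel false true  false true  ()
  jumps-cancel false false true  true  ()
  jumps-cancel false false false false ()

  -- An EDGE edge: at every crossing the label rises by 0 or 1, and the
  -- outdegree of the edge-vertex is 1 or 4.
  Jumps : Z3 → Z3 → Z3 → Z3 → Set
  Jumps a₁ a₂ a₃ a₄ = a₁ ≡ a₄ ⊕ jump (a₁ ==₃ a₄) × a₂ ≡ a₁ ⊕ jump (a₁ ==₃ a₂)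
    × outCount (a₁ ==₃ a₄) (a₃ ==₃ a₂) (a₁ ==₃ a₂) (a₃ ==₃ a₄) ℕ.% 3 ≡ 1

  edgeType⇒jumps : ∀ a₁ a₂ a₃ a₄ → EdgeType a₁ a₂ a₃ a₄ → Jumps a₁ a₂ a₃ a₄
  edgeType⇒jumps q _ _ _ (inj₁ (refl , refl , refl)) = type0 q
    where type0 : ∀ q → Jumps q q q q
          type0 0F = refl , refl , refl
          type0 1F = refl , refl , refl
          type0 2F = refl , refl , refl
  edgeType⇒jumps _ q _ _ (inj₂ (inj₁ (inj₁ (refl , refl , refl)))) = type1 q
    where type1 : ∀ q → Jumps (prev3 q) q q (next3 q)
          type1 0F = refl , refl , refl
          type1 1F = refl , refl , refl
          type1 2F = refl , refl , refl
  edgeType⇒jumps _ _ _ q (inj₂ (inj₁ (inj₂ (refl , refl , refl)))) = type1' q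
    where type1' : ∀ q → Jumps q (next3 q) (prev3 q) q
          type1' 0F = refl , refl , refl
          type1' 1F = refl , refl , refl
          type1' 2F = refl , refl , refl
  edgeType⇒jumps _ _ q _ (inj₂ (inj₂ (inj₁ (refl , refl , refl)))) = type2 q
    where type2 : ∀ q → Jumps (next3 q) (prev3 q) q q
          type2 0F = refl , refl , refl
          type2 1F = refl , refl , refl
          type2 2F = refl , refl , refl
  edgeType⇒jumps q _ _ _ (inj₂ (inj₂ (inj₂ (refl , refl , refl)))) = type2' q
    where type2' : ∀ q → Jumps q q (next3 q) (prev3 q)
          type2' 0F = refl , refl , refl
          type2' 1F = refl , refl , refl
          type2' 2F = refl , refl , refl

  jumps⇒edgeType : ∀ a₁ a₂ a₃ a₄ v f v' f' → a₁ ≡ a₄ ⊕ jump v → a₂ ≡ a₁ ⊕ jump f → a₃ ≡ a₂ ⊕ jump v' →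
    outCount v v' f f' ℕ.% 3 ≡ 1 → EdgeType a₁ a₂ a₃ a₄
  jumps⇒edgeType _ _ _ a₄ v f v' f' refl refl refl = around a₄ v f v' f'
    where
      around : ∀ a₄ v f v' f' → outCount v v' f f' ℕ.% 3 ≡ 1 →
        EdgeType (a₄ ⊕ jump v) (a₄ ⊕ jump v ⊕ jump f) (a₄ ⊕ jump v ⊕ jump f ⊕ jump v') a₄
      around 0F true  true  true  true  _ = inj₁ (refl , refl , refl)
      around 1F true  true  true  true  _ = inj₁ (refl , refl , refl)
      around 2F true  true  true  true  _ = inj₁ (refl , refl , refl)
      around 0F true  false false false _ = inj₂ (inj₁ (inj₂ (refl , refl , refl)))
      around 1F true  false false false _ = inj₂ (inj₁ (inj₂ (refl , refl , refl)))
      around 2F true  false false false _ = inj₂ (inj₁ (inj₂ (refl , refl , refl)))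
      around 0F false true  false false _ = inj₂ (inj₂ (inj₂ (refl , refl , refl)))
      around 1F false true  false false _ = inj₂ (inj₂ (inj₂ (refl , refl , refl)))
      around 2F false true  false false _ = inj₂ (inj₂ (inj₂ (refl , refl , refl)))
      around 0F false false true  false _ = inj₂ (inj₁ (inj₁ (refl , refl , refl)))
      around 1F false false true  false _ = inj₂ (inj₁ (inj₁ (refl , refl , refl)))
      around 2F false false true  false _ = inj₂ (inj₁ (inj₁ (refl , refl , refl)))
      around 0F false false false true  _ = inj₂ (inj₂ (inj₁ (refl , refl , refl)))
      around 1F false false false true  _ = inj₂ (inj₂ (inj₁ (refl , refl , refl)))
      around 2F false false false true  _ = inj₂ (inj₂ (inj₁ (refl , refl , refl)))
      around _ true  true  true  false ()
      around _ true  true  false true  ()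
      around _ true  true  false false ()
      around _ true  false true  true  ()
      around _ true  false true  false ()
      around _ true  false false true  ()
      around _ false true  true  true  ()
      around _ false true  true  false ()
      around _ false true  false true  ()
      around _ false false true  true  ()
      around _ false false false false ()

module OnMap {n : ℕ} (M : Map n) where

  open import Data.Nat as ℕ using (_≤_; _<_; z≤n; s≤s)
  import Data.Nat.Properties as ℕₚ
  open import Data.Fin.Patterns using (0F; 1F)
  open import Data.Bool using (true; false; not; _∧_)
  open import Data.Bool.Properties using (⇔→≡; T-≡)
  open import Data.List using ([]; _∷_; _++_; [_]; zip)
  open import Data.Product using (Σ; proj₁; proj₂)
  open import Data.Sum using (inj₁; inj₂)
  open import Data.Unit using (tt)
  open import Data.Integer as ℤ using (ℤ)
  open import Function using (_∘_; Equivalence)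
  open Equivalence using (to; from)
  open import Relation.Nullary.Decidable using (toWitness; fromWitness)
  open ≡-Reasoning
  open Map M
  open MapDefs M
  open ℤ₃
  open Reduction
  open Sums hiding (_==_)
  open EdgeLocal hiding (_==₃_)

  -- The three permutations whose orbits are the vertices (σ), the faces
  -- seen as cyclic sequences of darts (φ = σ ∘ α) and the faces seen as
  -- cyclic sequences of angles (faceOfAngle = α ∘ σ).
  φφ⁻¹ : ∀ x → σ (α (α (σ⁻¹ x))) ≡ x
  φφ⁻¹ x = trans (cong σ (αα (σ⁻¹ x))) (σσ⁻¹ x)

  φ⁻¹φ : ∀ x → α (σ⁻¹ (σ (α x))) ≡ x
  φ⁻¹φ x = trans (cong α (σ⁻¹σ (α x))) (αα x)

  θθ⁻¹ : ∀ x → α (σ (σ⁻¹ (α x))) ≡ x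
  θθ⁻¹ x = trans (cong α (σσ⁻¹ (α x))) (αα x)

  θ⁻¹θ : ∀ x → σ⁻¹ (α (α (σ x))) ≡ x
  θ⁻¹θ x = trans (cong σ⁻¹ (αα (σ x))) (σ⁻¹σ x)

  module V = Orbit σ σ⁻¹ σσ⁻¹ σ⁻¹σ
  module VS = OrbitSums σ σ⁻¹ σσ⁻¹ σ⁻¹σ
  module F = Orbit (σ ∘ α) (α ∘ σ⁻¹) φφ⁻¹ φ⁻¹φ
  module FS = OrbitSums (σ ∘ α) (α ∘ σ⁻¹) φφ⁻¹ φ⁻¹φ
  module A = Orbit (α ∘ σ) (σ⁻¹ ∘ α) θθ⁻¹ θ⁻¹θ
  module AS = OrbitSums (α ∘ σ) (σ⁻¹ ∘ α) θθ⁻¹ θ⁻¹θ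

  α-conj : ∀ k d → α (iter (σ ∘ α) k d) ≡ iter (α ∘ σ) k (α d)
  α-conj zero d = refl
  α-conj (suc k) d = cong (α ∘ σ) (α-conj k d)

  faceOrbit-α : ∀ d x → sameOrbit (σ ∘ α) d x ≡ sameOrbit faceOfAngle (α d) (α x)
  faceOrbit-α d x = ⇔→≡ {z = true} (mk⇔
    (λ e → let k , _ , eq = F.SO-elim d x e in
           A.SO-intro k (α d) (α x) (trans (sym (α-conj k d)) (cong α eq)))
    (λ e → let k , _ , eq = A.SO-elim (α d) (α x) e in
           F.SO-intro k d x (trans (sym (αα _)) (trans (cong α (α-conj k d)) (trans (cong α eq) (αα x))))))

  -- The darts at
  -- which a route applies α are the edges of G it crosses; they form a walk
  -- of G from the vertex of its start to the vertex of its end.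
  data Move : Set where
    rot rot⁻¹ flip : Move

  move : Move → D → D
  move rot = σ
  move rot⁻¹ = σ⁻¹
  move flip = α

  inverse : Move → Move
  inverse rot = rot⁻¹
  inverse rot⁻¹ = rot
  inverse flip = flip

  move-inverse : ∀ m a → move (inverse m) (move m a) ≡ a
  move-inverse rot a = σ⁻¹σ a
  move-inverse rot⁻¹ a = σσ⁻¹ a
  move-inverse flip a = αα a

  endpoint : D → List Move → D
  endpoint a [] = a
  endpoint a (m ∷ ms) = endpoint (move m a) ms

  crossings : D → List Move → List D
  crossings a [] = []
  crossings a (rot ∷ ms) = crossings (σ a) ms
  crossings a (rot⁻¹ ∷ ms) = crossings (σ⁻¹ a) ms
  crossings a (flip ∷ ms) = a ∷ crossings (α a) ms

  endpoint-++ : ∀ a ms ms' → endpoint a (ms ++ ms') ≡ endpoint (endpoint a ms) ms'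
  endpoint-++ a [] ms' = refl
  endpoint-++ a (m ∷ ms) ms' = endpoint-++ (move m a) ms ms'

  crossings-++ : ∀ a ms ms' → crossings a (ms ++ ms') ≡ crossings a ms ++ crossings (endpoint a ms) ms'
  crossings-++ a [] ms' = refl
  crossings-++ a (rot ∷ ms) ms' = crossings-++ (σ a) ms ms'
  crossings-++ a (rot⁻¹ ∷ ms) ms' = crossings-++ (σ⁻¹ a) ms ms'
  crossings-++ a (flip ∷ ms) ms' = cong (a ∷_) (crossings-++ (α a) ms ms')

  reverse : List Move → List Move
  reverse [] = []
  reverse (m ∷ ms) = reverse ms ++ [ inverse m ]

  endpoint-reverse : ∀ a ms → endpoint (endpoint a ms) (reverse ms) ≡ a
  endpoint-reverse a [] = refl
  endpoint-reverse a (m ∷ ms) = begin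
    endpoint (endpoint (move m a) ms) (reverse ms ++ [ inverse m ])
      ≡⟨ endpoint-++ (endpoint (move m a) ms) (reverse ms) [ inverse m ] ⟩
    move (inverse m) (endpoint (endpoint (move m a) ms) (reverse ms))
      ≡⟨ cong (move (inverse m)) (endpoint-reverse (move m a) ms) ⟩
    move (inverse m) (move m a)
      ≡⟨ move-inverse m a ⟩
    a ∎

  -- WalkFrom a ds b: ds is a walk of G starting at the vertex of a and
  -- ending at the vertex of b (ChainTo e ds b: continuing after dart e).
  ChainTo : D → List D → D → Set
  ChainTo e [] b = sameOrbit σ (α e) b ≡ true
  ChainTo e (y ∷ ys) b = Follows e y × ChainTo y ys b

  WalkFrom : D → List D → D → Set
  WalkFrom a [] b = sameOrbit σ a b ≡ true
  WalkFrom a (e ∷ es) b = sameOrbit σ a e ≡ true × ChainTo e es b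

  walkFrom-σ : ∀ a a' ds b → sameOrbit σ a a' ≡ true → WalkFrom a' ds b → WalkFrom a ds b
  walkFrom-σ a a' [] b aa' w = V.SO-trans a a' b aa' w
  walkFrom-σ a a' (e ∷ es) b aa' (a'e , w) = V.SO-trans a a' e aa' a'e , w

  route-walk : ∀ a ms → WalkFrom a (crossings a ms) (endpoint a ms)
  route-walk a [] = V.SO-refl a
  route-walk a (rot ∷ ms) = walkFrom-σ a (σ a) _ _ (V.SO-step a) (route-walk (σ a) ms)
  route-walk a (rot⁻¹ ∷ ms) = walkFrom-σ a (σ⁻¹ a) _ _ (trans (V.SO-g a a) (V.SO-refl a)) (route-walk (σ⁻¹ a) ms)
  route-walk a (flip ∷ ms) = V.SO-refl a , chainTo (crossings (α a) ms) (route-walk (α a) ms)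
    where
      chainTo : ∀ ds → WalkFrom (α a) ds (endpoint (α a) ms) → ChainTo a ds (endpoint (α a) ms)
      chainTo [] w = w
      chainTo (e ∷ es) w = w

  chainTo⇒chain : ∀ e es b f → ChainTo e es b → sameOrbit σ b f ≡ true → Chain e es f
  chainTo⇒chain e [] b f c bf = V.SO-trans (α e) b f c bf
  chainTo⇒chain e (y ∷ ys) b f (ey , c) bf = ey , chainTo⇒chain y ys b f c bf

  loop⇒closedWalk : ∀ r ms → endpoint r ms ≡ r → ClosedWalk (crossings r ms)
  loop⇒closedWalk r ms e = closed (crossings r ms) (subst (WalkFrom r (crossings r ms)) e (route-walk r ms))
    where
      closed : ∀ ds → WalkFrom r ds r → ClosedWalk ds
      closed [] _ = tt
      closed (d ∷ ds) (rd , c) = chainTo⇒chain d ds r d c rd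

  route : ∀ {a b} → Reach σ σ⁻¹ α a b → Σ (List Move) λ ms → endpoint a ms ≡ b
  route here = [] , refl
  route {a} (stepσ p) = let ms , e = route p in ms ++ [ rot ] , trans (endpoint-++ a ms [ rot ]) (cong σ e)
  route {a} (stepσ⁻¹ p) = let ms , e = route p in ms ++ [ rot⁻¹ ] , trans (endpoint-++ a ms [ rot⁻¹ ]) (cong σ⁻¹ e)
  route {a} (stepα p) = let ms , e = route p in ms ++ [ flip ] , trans (endpoint-++ a ms [ flip ]) (cong α e)

  module Integration (K : D → Z3) (K-anti : ∀ d → K (α d) ≡ ⊝ K d)
                     (K-closed : ∀ w → ClosedWalk w → ΣL K w ≡ 0F) where

    value : D → List Move → Z3
    value a ms = ΣL K (crossings a ms)

    value-++ : ∀ a ms ms' → value a (ms ++ ms') ≡ value a ms ⊕ value (endpoint a ms) ms'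
    value-++ a ms ms' = trans (cong (ΣL K) (crossings-++ a ms ms')) (ΣL-++ K (crossings a ms) _)

    value-reverse : ∀ a ms → value (endpoint a ms) (reverse ms) ≡ ⊝ value a ms
    value-reverse a [] = refl
    value-reverse a (m ∷ ms) =
      trans (value-++ (endpoint (move m a) ms) (reverse ms) [ inverse m ])
        (trans (cong₂ _⊕_ (value-reverse (move m a) ms)
                          (cong (λ t → value t [ inverse m ]) (endpoint-reverse (move m a) ms)))
               (back m))
      where
        back : ∀ m → ⊝ value (move m a) ms ⊕ value (move m a) [ inverse m ] ≡ ⊝ value a (m ∷ ms)
        back rot = ⊕-identityʳ _
        back rot⁻¹ = ⊕-identityʳ _
        back flip = begin
          ⊝ value (α a) ms ⊕ (K (α a) ⊕ 0F)   ≡⟨ cong (⊝ value (α a) ms ⊕_) (trans (⊕-identityʳ (K (α a))) (K-anti a)) ⟩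
          ⊝ value (α a) ms ⊕ ⊝ K a            ≡⟨ identity 2 (λ x y → ⊝ x ⊕ ⊝ y) (λ x y → ⊝ (y ⊕ x)) (value (α a) ms) (K a) refl ⟩
          ⊝ (K a ⊕ value (α a) ms)            ∎

    value-endpoint : ∀ r ms ms' → endpoint r ms ≡ endpoint r ms' → value r ms ≡ value r ms'
    value-endpoint r ms ms' e = trans (⊝≡⇒≡⊕ (value r ms) (value r ms') 0F loop) (⊕-identityʳ (value r ms'))
      where
        returns : endpoint r (ms ++ reverse ms') ≡ r
        returns = trans (endpoint-++ r ms (reverse ms'))
                        (trans (cong (λ t → endpoint t (reverse ms')) e) (endpoint-reverse r ms'))
        loop : value r ms ⊝ value r ms' ≡ 0F
        loop = begin
          value r ms ⊕ ⊝ value r ms'                          ≡⟨ cong (value r ms ⊕_) (sym (value-reverse r ms')) ⟩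
          value r ms ⊕ value (endpoint r ms') (reverse ms')   ≡⟨ cong (λ t → value r ms ⊕ value t (reverse ms')) (sym e) ⟩
          value r ms ⊕ value (endpoint r ms) (reverse ms')    ≡⟨ sym (value-++ r ms (reverse ms')) ⟩
          value r (ms ++ reverse ms')                         ≡⟨ K-closed (crossings r (ms ++ reverse ms')) (loop⇒closedWalk r (ms ++ reverse ms') returns) ⟩
          0F                                                  ∎

    -- a base point, the same for every dart (there is one as soon as D is inhabited)
    base : ∀ {m} → Fin m → Fin m
    base {suc m} _ = Fin.zero

    base-const : ∀ {m} (d e : Fin m) → base d ≡ base e
    base-const {suc m} d e = refl

    t : D → Z3
    t d = value (base d) (proj₁ (route (connected (base d) d)))

    t-move : ∀ d m → t (move m d) ≡ t d ⊕ value d [ m ]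
    t-move d m = begin
      t (move m d)                           ≡⟨ cong (λ r → value r (proj₁ (route (connected r (move m d))))) (base-const (move m d) d) ⟩
      value r (proj₁ (route (connected r (move m d))))
        ≡⟨ value-endpoint r (proj₁ (route (connected r (move m d)))) (ms ++ [ m ]) (trans (proj₂ (route (connected r (move m d))))
                                                   (sym (trans (endpoint-++ r ms [ m ]) (cong (move m) e)))) ⟩
      value r (ms ++ [ m ])                  ≡⟨ value-++ r ms [ m ] ⟩
      t d ⊕ value (endpoint r ms) [ m ]      ≡⟨ cong (λ x → t d ⊕ value x [ m ]) e ⟩
      t d ⊕ value d [ m ]                    ∎
      where
        r : D
        r = base d
        ms : List Move
        ms = proj₁ (route (connected r d))
        e : endpoint r ms ≡ d
        e = proj₂ (route (connected r d))

  integrate : (K : D → Z3) → (∀ d → K (α d) ≡ ⊝ K d) → (∀ w → ClosedWalk w → ΣL K w ≡ 0F) →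
    Σ (D → Z3) λ t → (∀ d → t (σ d) ≡ t d) × (∀ d → t (α d) ≡ t d ⊕ K d)
  integrate K K-anti K-closed =
    t , (λ d → trans (t-move d rot) (⊕-identityʳ (t d))) , (λ d → trans (t-move d flip) (cong (t d ⊕_) (⊕-identityʳ (K d))))
    where open Integration K K-anti K-closed

  -- Each dart carries its flow and the flow of its
  -- reversal, so a walk w pairs to 2·ΣK(w); faces pair to 0.  Hence if K
  -- vanishes (doubled) on a homology basis, it vanishes on all closed walks.
  module Homology (K : D → Z3) (K-anti : ∀ d → K (α d) ≡ ⊝ K d)
                  (K-faces : ∀ d → FS.orbitSum K d ≡ 0F) where

    pairing : (D → ℤ) → Z3
    pairing F = sum (λ x → red (F x) ⊗ K x)

    sum-∘α : ∀ (h : D → Z3) → sum (λ x → h (α x)) ≡ sum h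
    sum-∘α h = sym (sum-reindex α α αα αα h)

    K-faces-α : ∀ d → sum (λ x → 𝟙 (sameOrbit (σ ∘ α) d (α x)) ⊗ K x) ≡ 0F
    K-faces-α d = begin
      sum (λ x → 𝟙 (F.SameOrbit d (α x)) ⊗ K x)          ≡⟨ sum-cong-≗ (λ x → cong (𝟙 (F.SameOrbit d (α x)) ⊗_) (sym (cong K (αα x)))) ⟩
      sum (λ x → 𝟙 (F.SameOrbit d (α x)) ⊗ K (α (α x)))  ≡⟨ sum-∘α (λ y → 𝟙 (F.SameOrbit d y) ⊗ K (α y)) ⟩
      sum (λ y → 𝟙 (F.SameOrbit d y) ⊗ K (α y))          ≡⟨ FS.orbitSum-cong K-anti d ⟩
      FS.orbitSum (λ y → ⊝ K y) d                         ≡⟨ trans (FS.orbitSum-⊝ K d) (cong ⊝_ (K-faces d)) ⟩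
      0F                                                  ∎

    pairing-face : ∀ d → pairing (faceFlow d) ≡ 0F
    pairing-face d = begin
      sum (λ x → red (faceFlow d x) ⊗ K x)
        ≡⟨ sum-cong-≗ split ⟩
      sum (λ x → 𝟙 (F.SameOrbit d x) ⊗ K x ⊕ ⊝ (𝟙 (F.SameOrbit d (α x)) ⊗ K x))
        ≡⟨ ∑-distrib-+ (λ x → 𝟙 (F.SameOrbit d x) ⊗ K x) _ ⟩
      FS.orbitSum K d ⊕ sum (λ x → ⊝ (𝟙 (F.SameOrbit d (α x)) ⊗ K x))
        ≡⟨ cong₂ _⊕_ (K-faces d) (trans (sum-⊝ (λ x → 𝟙 (F.SameOrbit d (α x)) ⊗ K x)) (cong ⊝_ (K-faces-α d))) ⟩
      0F ∎
      where
        red-b2z : ∀ b → red (b2z b) ≡ 𝟙 b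
        red-b2z true = refl
        red-b2z false = refl
        split : ∀ x → red (faceFlow d x) ⊗ K x ≡ 𝟙 (F.SameOrbit d x) ⊗ K x ⊕ ⊝ (𝟙 (F.SameOrbit d (α x)) ⊗ K x)
        split x = begin
          red (faceFlow d x) ⊗ K x
            ≡⟨ cong (_⊗ K x) (trans (red-- (b2z (F.SameOrbit d x)) (b2z (F.SameOrbit d (α x))))
                                    (cong₂ _⊝_ (red-b2z (F.SameOrbit d x)) (red-b2z (F.SameOrbit d (α x))))) ⟩
          (𝟙 (F.SameOrbit d x) ⊝ 𝟙 (F.SameOrbit d (α x))) ⊗ K x
            ≡⟨ identity 3 (λ a b k → (a ⊝ b) ⊗ k) (λ a b k → a ⊗ k ⊕ ⊝ (b ⊗ k)) (𝟙 (F.SameOrbit d x)) (𝟙 (F.SameOrbit d (α x))) (K x) refl ⟩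
          𝟙 (F.SameOrbit d x) ⊗ K x ⊕ ⊝ (𝟙 (F.SameOrbit d (α x)) ⊗ K x) ∎

    pairing-dart : ∀ y → sum (λ x → (𝟙 (y == x) ⊝ 𝟙 (y == α x)) ⊗ K x) ≡ K y ⊕ K y
    pairing-dart y = begin
      sum (λ x → (𝟙 (y == x) ⊝ 𝟙 (y == α x)) ⊗ K x)
        ≡⟨ sum-cong-≗ (λ x → identity 3 (λ a b k → (a ⊝ b) ⊗ k) (λ a b k → a ⊗ k ⊕ ⊝ (b ⊗ k)) (𝟙 (y == x)) (𝟙 (y == α x)) (K x) refl) ⟩
      sum (λ x → 𝟙 (y == x) ⊗ K x ⊕ ⊝ (𝟙 (y == α x) ⊗ K x))
        ≡⟨ ∑-distrib-+ (λ x → 𝟙 (y == x) ⊗ K x) _ ⟩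
      sum (λ x → 𝟙 (y == x) ⊗ K x) ⊕ sum (λ x → ⊝ (𝟙 (y == α x) ⊗ K x))
        ≡⟨ cong₂ _⊕_ (sum-indicator y K) (sum-⊝ (λ x → 𝟙 (y == α x) ⊗ K x)) ⟩
      K y ⊕ ⊝ sum (λ x → 𝟙 (y == α x) ⊗ K x)
        ≡⟨ cong (λ s → K y ⊕ ⊝ s) reversed ⟩
      K y ⊕ ⊝ K (α y)
        ≡⟨ cong (λ s → K y ⊕ ⊝ s) (K-anti y) ⟩
      K y ⊕ ⊝ ⊝ K y
        ≡⟨ cong (K y ⊕_) (⊝-involutive (K y)) ⟩
      K y ⊕ K y ∎
      where
        reversed : sum (λ x → 𝟙 (y == α x) ⊗ K x) ≡ K (α y)
        reversed = begin
          sum (λ x → 𝟙 (y == α x) ⊗ K x)             ≡⟨ sym (sum-∘α (λ x → 𝟙 (y == α x) ⊗ K x)) ⟩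
          sum (λ x → 𝟙 (y == α (α x)) ⊗ K (α x))     ≡⟨ sum-cong-≗ (λ x → cong (λ u → 𝟙 (y == u) ⊗ K (α x)) (αα x)) ⟩
          sum (λ x → 𝟙 (y == x) ⊗ K (α x))           ≡⟨ sum-indicator y (K ∘ α) ⟩
          K (α y)                                    ∎

    red-flow-∷ : ∀ y w x → red (flow (y ∷ w) x) ≡ (𝟙 (y == x) ⊝ 𝟙 (y == α x)) ⊕ red (flow w x)
    red-flow-∷ y w x = begin
      red (flow (y ∷ w) x)
        ≡⟨ red-- (+ countB (_== x) (y ∷ w)) (+ countB (_== α x) (y ∷ w)) ⟩
      redℕ (countB (_== x) (y ∷ w)) ⊝ redℕ (countB (_== α x) (y ∷ w))
        ≡⟨ cong₂ _⊝_ (redℕ-countB (_== x) (y ∷ w)) (redℕ-countB (_== α x) (y ∷ w)) ⟩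
      (𝟙 (y == x) ⊕ ΣL (λ z → 𝟙 (z == x)) w) ⊝ (𝟙 (y == α x) ⊕ ΣL (λ z → 𝟙 (z == α x)) w)
        ≡⟨ identity 4 (λ a b c d → (a ⊕ b) ⊝ (c ⊕ d)) (λ a b c d → (a ⊝ c) ⊕ (b ⊝ d))
                      (𝟙 (y == x)) (ΣL (λ z → 𝟙 (z == x)) w) (𝟙 (y == α x)) (ΣL (λ z → 𝟙 (z == α x)) w) refl ⟩
      (𝟙 (y == x) ⊝ 𝟙 (y == α x)) ⊕ (ΣL (λ z → 𝟙 (z == x)) w ⊝ ΣL (λ z → 𝟙 (z == α x)) w)
        ≡⟨ cong ((𝟙 (y == x) ⊝ 𝟙 (y == α x)) ⊕_) (sym (trans (red-- (+ countB (_== x) w) (+ countB (_== α x) w))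
                                                          (cong₂ _⊝_ (redℕ-countB (_== x) w) (redℕ-countB (_== α x) w)))) ⟩
      (𝟙 (y == x) ⊝ 𝟙 (y == α x)) ⊕ red (flow w x) ∎

    pairing-flow : ∀ w → pairing (flow w) ≡ ΣL (λ y → K y ⊕ K y) w
    pairing-flow [] = sum-zero (λ x → 0F ⊗ K x) (λ x → refl)
    pairing-flow (y ∷ w) = begin
      sum (λ x → red (flow (y ∷ w) x) ⊗ K x)
        ≡⟨ sum-cong-≗ (λ x → trans (cong (_⊗ K x) (red-flow-∷ y w x)) (⊗-distribʳ (K x) (𝟙 (y == x) ⊝ 𝟙 (y == α x)) (red (flow w x)))) ⟩
      sum (λ x → (𝟙 (y == x) ⊝ 𝟙 (y == α x)) ⊗ K x ⊕ red (flow w x) ⊗ K x)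
        ≡⟨ ∑-distrib-+ (λ x → (𝟙 (y == x) ⊝ 𝟙 (y == α x)) ⊗ K x) (λ x → red (flow w x) ⊗ K x) ⟩
      sum (λ x → (𝟙 (y == x) ⊝ 𝟙 (y == α x)) ⊗ K x) ⊕ pairing (flow w)
        ≡⟨ cong₂ _⊕_ (pairing-dart y) (pairing-flow w) ⟩
      (K y ⊕ K y) ⊕ ΣL (λ y → K y ⊕ K y) w ∎

    pairing-combination : ∀ m (c : Fin m → Z3) (G : Fin m → D → Z3) →
      (∀ i → sum (λ x → G i x ⊗ K x) ≡ 0F) → sum (λ x → sum (λ i → c i ⊗ G i x) ⊗ K x) ≡ 0F
    pairing-combination m c G G-zero = begin
      sum (λ x → sum (λ i → c i ⊗ G i x) ⊗ K x)
        ≡⟨ sum-cong-≗ (λ x → trans (⊗-comm (sum (λ i → c i ⊗ G i x)) (K x)) (trans (sym (sum-⊗ (K x) (λ i → c i ⊗ G i x)))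
                               (sum-cong-≗ (λ i → identity 3 (λ k a b → k ⊗ (a ⊗ b)) (λ k a b → a ⊗ (b ⊗ k)) (K x) (c i) (G i x) refl)))) ⟩
      sum (λ x → sum (λ i → c i ⊗ (G i x ⊗ K x)))
        ≡⟨ ∑-comm (λ x i → c i ⊗ (G i x ⊗ K x)) ⟩
      sum (λ i → sum (λ x → c i ⊗ (G i x ⊗ K x)))
        ≡⟨ sum-cong-≗ (λ i → trans (sum-⊗ (c i) (λ x → G i x ⊗ K x)) (trans (cong (c i ⊗_) (G-zero i)) (⊗-zeroʳ (c i)))) ⟩
      sum {m} (λ i → 0F)
        ≡⟨ sum-zero {m} (λ i → 0F) (λ i → refl) ⟩
      0F ∎

    red-combination : ∀ m (c : Fin m → ℤ) (G : Fin m → D → ℤ) x →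
      red (sumFin m (λ i → c i ℤ.* G i x)) ≡ sum (λ i → red (c i) ⊗ red (G i x))
    red-combination m c G x = trans (red-sumFin m (λ i → c i ℤ.* G i x)) (sum-cong-≗ (λ i → red-* (c i) (G i x)))

    closed-walks : ∀ k (B : Fin k → List D) → IsHomologyBasis k B →
      (∀ i → ΣL (λ y → K y ⊕ K y) (B i) ≡ 0F) → ∀ w → ClosedWalk w → ΣL K w ≡ 0F
    closed-walks k B basis B-zero w closed with basis w closed
    ... | c , b , decomposition = double≡0 (ΣL K w) (trans (sym (ΣL-⊕ K K w)) (trans (sym (pairing-flow w)) pairs-to-0))
      where
        pairs-to-0 : pairing (flow w) ≡ 0F
        pairs-to-0 = begin
          sum (λ x → red (flow w x) ⊗ K x)
            ≡⟨ sum-cong-≗ (λ x → cong (_⊗ K x) (trans (cong red (decomposition x))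
                 (trans (red-+ (sumFin k (λ i → c i ℤ.* flow (B i) x)) (sumFin n (λ d → b d ℤ.* faceFlow d x)))
                        (cong₂ _⊕_ (red-combination k c (λ i → flow (B i)) x) (red-combination n b faceFlow x))))) ⟩
          sum (λ x → (sum (λ i → red (c i) ⊗ red (flow (B i) x)) ⊕ sum (λ d → red (b d) ⊗ red (faceFlow d x))) ⊗ K x)
            ≡⟨ sum-cong-≗ (λ x → ⊗-distribʳ (K x) (sum (λ i → red (c i) ⊗ red (flow (B i) x))) (sum (λ d → red (b d) ⊗ red (faceFlow d x)))) ⟩
          sum (λ x → sum (λ i → red (c i) ⊗ red (flow (B i) x)) ⊗ K x ⊕ sum (λ d → red (b d) ⊗ red (faceFlow d x)) ⊗ K x)
            ≡⟨ ∑-distrib-+ (λ x → sum (λ i → red (c i) ⊗ red (flow (B i) x)) ⊗ K x) _ ⟩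
          _ ≡⟨ cong₂ _⊕_ (pairing-combination k (red ∘ c) (λ i x → red (flow (B i) x)) (λ i → trans (pairing-flow (B i)) (B-zero i)))
                         (pairing-combination n (red ∘ b) (λ d x → red (faceFlow d x)) pairing-face) ⟩
          0F ∎

  faceOrbitSum-α : ∀ (h : D → Z3) d → FS.orbitSum (λ x → h (α x)) d ≡ AS.orbitSum h (α d)
  faceOrbitSum-α h d = begin
    sum (λ x → 𝟙 (F.SameOrbit d x) ⊗ h (α x))              ≡⟨ sum-cong-≗ (λ x → cong (λ b → 𝟙 b ⊗ h (α x)) (faceOrbit-α d x)) ⟩
    sum (λ x → 𝟙 (A.SameOrbit (α d) (α x)) ⊗ h (α x))       ≡⟨ sym (sum-reindex α α αα αα (λ y → 𝟙 (A.SameOrbit (α d) y) ⊗ h y)) ⟩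
    AS.orbitSum h (α d)                                     ∎

  red-sumL : ∀ {A : Set} (f : A → ℤ) xs → red (sumL (mapL f xs)) ≡ ΣL (λ a → red (f a)) xs
  red-sumL f [] = refl
  red-sumL f (x ∷ xs) = trans (red-+ (f x) _) (cong (red (f x) ⊕_) (red-sumL f xs))

  cyclic-sum : ∀ (G H : D → Z3) x xs →
    ΣL (λ pc → G (proj₂ pc) ⊕ H (proj₁ pc)) (cycPairs (x ∷ xs)) ≡ ΣL (λ c → G c ⊕ H c) (x ∷ xs)
  cyclic-sum G H x xs = begin
    G x ⊕ H (lastOr x xs) ⊕ ΣL GH (zip (x ∷ xs) xs)   ≡⟨ identity 3 (λ a b c → a ⊕ b ⊕ c) (λ a b c → a ⊕ (c ⊕ b)) (G x) (H (lastOr x xs)) _ refl ⟩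
    G x ⊕ (ΣL GH (zip (x ∷ xs) xs) ⊕ H (lastOr x xs)) ≡⟨ cong (G x ⊕_) (shifted x xs) ⟩
    G x ⊕ (H x ⊕ ΣL (λ c → G c ⊕ H c) xs)             ≡⟨ sym (⊕-assoc (G x) (H x) _) ⟩
    G x ⊕ H x ⊕ ΣL (λ c → G c ⊕ H c) xs               ∎
    where
      GH : D × D → Z3
      GH (p , c) = G c ⊕ H p
      shifted : ∀ p ys → ΣL GH (zip (p ∷ ys) ys) ⊕ H (lastOr p ys) ≡ H p ⊕ ΣL (λ c → G c ⊕ H c) ys
      shifted p [] = sym (⊕-identityʳ (H p))
      shifted p (y ∷ ys) = begin
        G y ⊕ H p ⊕ ΣL GH (zip (y ∷ ys) ys) ⊕ H (lastOr y ys)   ≡⟨ ⊕-assoc (G y ⊕ H p) _ _ ⟩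
        G y ⊕ H p ⊕ (ΣL GH (zip (y ∷ ys) ys) ⊕ H (lastOr y ys)) ≡⟨ cong (G y ⊕ H p ⊕_) (shifted y ys) ⟩
        G y ⊕ H p ⊕ (H y ⊕ ΣL (λ c → G c ⊕ H c) ys)             ≡⟨ identity 4 (λ a b c d → a ⊕ b ⊕ (c ⊕ d)) (λ a b c d → b ⊕ (a ⊕ c ⊕ d)) (G y) (H p) (H y) _ refl ⟩
        H p ⊕ (G y ⊕ H y ⊕ ΣL (λ c → G c ⊕ H c) ys)             ∎

  cyclic-sum-cong : ∀ {F F' : D × D → Z3} x xs → Chain x xs x → (∀ p c → Follows p c → F (p , c) ≡ F' (p , c)) →
    ΣL F (cycPairs (x ∷ xs)) ≡ ΣL F' (cycPairs (x ∷ xs))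
  cyclic-sum-cong {F} {F'} x xs chain agree = cong₂ _⊕_ (agree (lastOr x xs) x (last-follows x xs chain)) (along x xs chain)
    where
      last-follows : ∀ p ys → Chain p ys x → Follows (lastOr p ys) x
      last-follows p [] c = c
      last-follows p (y ∷ ys) (_ , c) = last-follows y ys c
      along : ∀ p ys → Chain p ys x → ΣL F (zip (p ∷ ys) ys) ≡ ΣL F' (zip (p ∷ ys) ys)
      along p [] c = refl
      along p (y ∷ ys) (py , c) = cong₂ _⊕_ (agree p y py) (along y ys c)

  module WithOrientation (o : Orientation) where

    -- jumps of the edges of Ĝ from the edge-vertex of d to tail d and to
    -- the face containing angle d
    jumpV jumpF : D → Z3
    jumpV d = jump (o (inj₁ d))
    jumpF d = jump (o (inj₂ d))

    -- A labeling rises by the jump when crossing an edge of Ĝ around a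
    -- vertex (angle σ⁻¹ d to angle d) or around a face (angle d to angle
    -- σ⁻¹ (α d)).
    VertexRule : (D → Z3) → Set
    VertexRule ψ = ∀ d → ψ d ≡ ψ (σ⁻¹ d) ⊕ jumpV d

    FaceRule : (D → Z3) → Set
    FaceRule ℓ = ∀ d → ℓ (σ⁻¹ (α d)) ≡ ℓ d ⊕ jumpF d

    EdgeVerticesOK : Set
    EdgeVerticesOK = ∀ d → outEdge o d ℕ.% 3 ≡ 1

    schnyder⇒rules : IsSchnyder o → EdgeVerticesOK × Σ Labeling (λ ℓ → VertexRule ℓ × FaceRule ℓ)
    schnyder⇒rules (ℓ , edge , ev , ef) = edgeVertices , ℓ , vertexRule , faceRule
      where
        local : ∀ d → Jumps (ℓ d) (ℓ (σ⁻¹ (α d))) (ℓ (α d)) (ℓ (σ⁻¹ d))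
        local d = edgeType⇒jumps (ℓ d) (ℓ (σ⁻¹ (α d))) (ℓ (α d)) (ℓ (σ⁻¹ d)) (edge d)
        vertexRule : VertexRule ℓ
        vertexRule d = trans (proj₁ (local d)) (cong (λ b → ℓ (σ⁻¹ d) ⊕ jump b) (sym (ev d)))
        faceRule : FaceRule ℓ
        faceRule d = trans (proj₁ (proj₂ (local d))) (cong (λ b → ℓ d ⊕ jump b) (sym (ef d)))
        count : ∀ d → outCount (o (inj₁ d)) (o (inj₁ (α d))) (o (inj₂ d)) (o (inj₂ (α d)))
                    ≡ outCount (ℓ d ==₃ ℓ (σ⁻¹ d)) (ℓ (α d) ==₃ ℓ (σ⁻¹ (α d))) (ℓ d ==₃ ℓ (σ⁻¹ (α d))) (ℓ (α d) ==₃ ℓ (σ⁻¹ d))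
        count d rewrite ev d | ev (α d) | ef d | ef (α d) | αα d = refl
        edgeVertices : EdgeVerticesOK
        edgeVertices d = subst (λ k → k ℕ.% 3 ≡ 1) (sym (count d)) (proj₂ (proj₂ (local d)))

    rules⇒schnyder : EdgeVerticesOK → (ℓ : Labeling) → VertexRule ℓ → FaceRule ℓ → IsSchnyder o
    rules⇒schnyder edgeVertices ℓ vertexRule faceRule = ℓ , edge , ev , ef
      where
        edge : EDGE ℓ
        edge d = jumps⇒edgeType (ℓ d) (ℓ (σ⁻¹ (α d))) (ℓ (α d)) (ℓ (σ⁻¹ d))
                   (o (inj₁ d)) (o (inj₂ d)) (o (inj₁ (α d))) (o (inj₂ (α d)))
                   (vertexRule d) (faceRule d) (vertexRule (α d)) (edgeVertices d)
        ev : ∀ d → o (inj₁ d) ≡ (ℓ d ==₃ ℓ (σ⁻¹ d))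
        ev d = trans (sym (jump-equal₁ (ℓ (σ⁻¹ d)) (o (inj₁ d)))) (cong (_==₃ ℓ (σ⁻¹ d)) (sym (vertexRule d)))
        ef : ∀ d → o (inj₂ d) ≡ (ℓ d ==₃ ℓ (σ⁻¹ (α d)))
        ef d = trans (sym (jump-equal₂ (ℓ d) (o (inj₂ d)))) (cong (ℓ d ==₃_) (sym (faceRule d)))

    outPrimal-mod3 : ∀ d → redℕ (outPrimal o d) ≡ VS.orbitSum jumpV d
    outPrimal-mod3 d = trans (redℕ-countB-allFin (λ x → sameOrbit σ d x ∧ not (o (inj₁ x))))
                             (sum-cong-≗ (λ x → 𝟙-∧ (sameOrbit σ d x) _))

    outDual-mod3 : ∀ d → redℕ (outDual o d) ≡ AS.orbitSum jumpF d
    outDual-mod3 d = trans (redℕ-countB-allFin (λ x → sameOrbit faceOfAngle d x ∧ not (o (inj₂ x))))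
                           (sum-cong-≗ (λ x → 𝟙-∧ (sameOrbit faceOfAngle d x) _))

    -- a labeling obeying a rule makes the jumps a coboundary, hence the
    -- outdegrees ≡ 0 (mod 3)
    vertexRule⇒outPrimal : ∀ {ℓ} → VertexRule ℓ → ∀ d → outPrimal o d ℕ.% 3 ≡ 0
    vertexRule⇒outPrimal {ℓ} rule d = redℕ≡0⇒%3≡0 (outPrimal o d) (begin
      redℕ (outPrimal o d)                       ≡⟨ outPrimal-mod3 d ⟩
      VS.orbitSum jumpV d                        ≡⟨ VS.orbitSum-cong (λ x → sym (≡⊕⇒⊝≡ (ℓ x) (ℓ (σ⁻¹ x)) (jumpV x) (rule x))) d ⟩
      VS.orbitSum (λ x → ℓ x ⊝ ℓ (σ⁻¹ x)) d      ≡⟨ VS.orbitSum-coboundary ℓ d ⟩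
      0F                                         ∎)

    faceRule⇒outDual : ∀ {ℓ} → FaceRule ℓ → ∀ d → outDual o d ℕ.% 3 ≡ 0
    faceRule⇒outDual {ℓ} rule d = redℕ≡0⇒%3≡0 (outDual o d) (begin
      redℕ (outDual o d)                                ≡⟨ outDual-mod3 d ⟩
      AS.orbitSum jumpF d                               ≡⟨ AS.orbitSum-cong (λ x → check-sound 3 (λ a b j → b) (λ a b j → a ⊕ j) (λ a b j → j) (λ a b j → ⊝ (a ⊝ b)) (ℓ x) (ℓ (σ⁻¹ (α x))) (jumpF x) (rule x)) d ⟩
      AS.orbitSum (λ x → ⊝ (ℓ x ⊝ ℓ (σ⁻¹ (α x)))) d     ≡⟨ AS.orbitSum-⊝ (λ x → ℓ x ⊝ ℓ (σ⁻¹ (α x))) d ⟩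
      ⊝ AS.orbitSum (λ x → ℓ x ⊝ ℓ (σ⁻¹ (α x))) d       ≡⟨ cong ⊝_ (AS.orbitSum-coboundary ℓ d) ⟩
      0F                                                ∎)

    outPrimal⇒vertexRule : (∀ d → outPrimal o d ℕ.% 3 ≡ 0) → Σ (D → Z3) VertexRule
    outPrimal⇒vertexRule primal = VS.potential jumpV (λ d → trans (sym (outPrimal-mod3 d)) (%3≡0⇒redℕ≡0 (outPrimal o d) (primal d)))

    faceDefect : (D → Z3) → D → Z3
    faceDefect ψ d = ψ d ⊝ ψ (σ⁻¹ (α d)) ⊕ jumpF d

    -- under the vertex rule the defect is antisymmetric: the jumps around
    -- each edge-vertex cancel
    faceDefect-anti : EdgeVerticesOK → ∀ {ψ} → VertexRule ψ → ∀ d → faceDefect ψ (α d) ≡ ⊝ faceDefect ψ d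
    faceDefect-anti edgeVertices {ψ} rule d = begin
      ψ (α d) ⊝ ψ (σ⁻¹ (α (α d))) ⊕ jumpF (α d)
        ≡⟨ cong₂ (λ u v → u ⊝ v ⊕ jumpF (α d)) (rule (α d)) (cong (ψ ∘ σ⁻¹) (αα d)) ⟩
      ψ (σ⁻¹ (α d)) ⊕ jumpV (α d) ⊝ ψ (σ⁻¹ d) ⊕ jumpF (α d)
        ≡⟨ check-sound 6 (λ A B v f v' f' → v ⊕ f ⊕ v' ⊕ f') (λ _ _ _ _ _ _ → 0F)
                         (λ A B v f v' f' → B ⊕ v' ⊝ A ⊕ f') (λ A B v f v' f' → ⊝ (A ⊕ v ⊝ B ⊕ f))
                         (ψ (σ⁻¹ d)) (ψ (σ⁻¹ (α d))) (jumpV d) (jumpF d) (jumpV (α d)) (jumpF (α d))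
                         (jumps-cancel (o (inj₁ d)) (o (inj₁ (α d))) (o (inj₂ d)) (o (inj₂ (α d))) (edgeVertices d)) ⟩
      ⊝ (ψ (σ⁻¹ d) ⊕ jumpV d ⊝ ψ (σ⁻¹ (α d)) ⊕ jumpF d)
        ≡⟨ cong (λ u → ⊝ (u ⊝ ψ (σ⁻¹ (α d)) ⊕ jumpF d)) (sym (rule d)) ⟩
      ⊝ faceDefect ψ d ∎

    faceDefect-faces : EdgeVerticesOK → (∀ d → outDual o d ℕ.% 3 ≡ 0) → ∀ {ψ} → VertexRule ψ →
      ∀ d → FS.orbitSum (faceDefect ψ) d ≡ 0F
    faceDefect-faces edgeVertices dual {ψ} rule d = begin
      FS.orbitSum (faceDefect ψ) d
        ≡⟨ FS.orbitSum-cong reversed d ⟩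
      FS.orbitSum (λ x → ⊝ (ψ (α x) ⊝ ψ (α (α (σ⁻¹ x)))) ⊕ ⊝ jumpF (α x)) d
        ≡⟨ FS.orbitSum-⊕ (λ x → ⊝ (ψ (α x) ⊝ ψ (α (α (σ⁻¹ x))))) (λ x → ⊝ jumpF (α x)) d ⟩
      FS.orbitSum (λ x → ⊝ (ψ (α x) ⊝ ψ (α (α (σ⁻¹ x))))) d ⊕ FS.orbitSum (λ x → ⊝ jumpF (α x)) d
        ≡⟨ cong₂ _⊕_ (trans (FS.orbitSum-⊝ (λ x → ψ (α x) ⊝ ψ (α (α (σ⁻¹ x)))) d) (cong ⊝_ (FS.orbitSum-coboundary (ψ ∘ α) d)))
                     (trans (FS.orbitSum-⊝ (λ x → jumpF (α x)) d) (cong ⊝_ (trans (faceOrbitSum-α jumpF d)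
                       (trans (sym (outDual-mod3 (α d))) (%3≡0⇒redℕ≡0 (outDual o (α d)) (dual (α d))))))) ⟩
      0F ∎
      where
        reversed : ∀ x → faceDefect ψ x ≡ ⊝ (ψ (α x) ⊝ ψ (α (α (σ⁻¹ x)))) ⊕ ⊝ jumpF (α x)
        reversed x = begin
          faceDefect ψ x                                      ≡⟨ sym (⊝-involutive (faceDefect ψ x)) ⟩
          ⊝ ⊝ faceDefect ψ x                                  ≡⟨ cong ⊝_ (sym (faceDefect-anti edgeVertices rule x)) ⟩
          ⊝ (ψ (α x) ⊝ ψ (σ⁻¹ (α (α x))) ⊕ jumpF (α x))       ≡⟨ cong (λ y → ⊝ (ψ (α x) ⊝ ψ y ⊕ jumpF (α x))) (trans (cong σ⁻¹ (αα x)) (sym (αα (σ⁻¹ x)))) ⟩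
          ⊝ (ψ (α x) ⊝ ψ (α (α (σ⁻¹ x))) ⊕ jumpF (α x))       ≡⟨ ⊝-distrib-⊕ (ψ (α x) ⊝ ψ (α (α (σ⁻¹ x)))) (jumpF (α x)) ⟩
          ⊝ (ψ (α x) ⊝ ψ (α (α (σ⁻¹ x)))) ⊕ ⊝ jumpF (α x)     ∎

    -- Around a vertex the jumps telescope: the jumps of the darts strictly
    -- between a and b add up to the potential difference across them.
    module AroundVertex {ψ} (rule : VertexRule ψ) where

      walkTo-sum : ∀ m x b j → j ≤ m → iter σ j x ≡ b → ΣL jumpV (walkTo σ m x b) ≡ ψ (σ⁻¹ b) ⊝ ψ (σ⁻¹ x)
      walkTo-sum zero x b zero z≤n e = sym (trans (cong (λ y → ψ (σ⁻¹ y) ⊝ ψ (σ⁻¹ x)) (sym e)) (⊕-inverseʳ (ψ (σ⁻¹ x))))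
      walkTo-sum (suc m) x b j j≤m e with x == b in x==b
      ... | true = sym (trans (cong (λ y → ψ (σ⁻¹ y) ⊝ ψ (σ⁻¹ x)) (sym (toWitness (from T-≡ x==b)))) (⊕-inverseʳ (ψ (σ⁻¹ x))))
      walkTo-sum (suc m) x b zero j≤m e | false with () ← trans (sym x==b) (to T-≡ (fromWitness e))
      walkTo-sum (suc m) x b (suc j) (s≤s j≤m) e | false = begin
        jumpV x ⊕ ΣL jumpV (walkTo σ m (σ x) b)     ≡⟨ cong (jumpV x ⊕_) (walkTo-sum m (σ x) b j j≤m (trans (sym (V.iter-suc j x)) e)) ⟩
        jumpV x ⊕ (ψ (σ⁻¹ b) ⊝ ψ (σ⁻¹ (σ x)))       ≡⟨ cong (λ y → jumpV x ⊕ (ψ (σ⁻¹ b) ⊝ ψ y)) (σ⁻¹σ x) ⟩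
        jumpV x ⊕ (ψ (σ⁻¹ b) ⊝ ψ x)                 ≡⟨ check-sound 4 (λ j a b' c → c) (λ j a b' c → a ⊕ j) (λ j a b' c → j ⊕ (b' ⊝ c)) (λ j a b' c → b' ⊝ a)
                                                        (jumpV x) (ψ (σ⁻¹ x)) (ψ (σ⁻¹ b)) (ψ x) (rule x) ⟩
        ψ (σ⁻¹ b) ⊝ ψ (σ⁻¹ x)                       ∎

      between-sum : ∀ a b → sameOrbit σ a b ≡ true → ΣL jumpV (between a b) ≡ ψ (σ⁻¹ b) ⊝ ψ a
      between-sum a b ab = trans (sum-from (V.SO-elim a b ab)) (cong (λ y → ψ (σ⁻¹ b) ⊝ ψ y) (σ⁻¹σ a))
        where
          sum-from : (Σ ℕ λ k → k < n × iter σ k a ≡ b) → ΣL jumpV (between a b) ≡ ψ (σ⁻¹ b) ⊝ ψ (σ⁻¹ (σ a))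
          sum-from (suc k , k<n , e) = walkTo-sum n (σ a) b k (ℕₚ.<⇒≤ (ℕₚ.<-trans (ℕₚ.n<1+n k) k<n)) (trans (sym (V.iter-suc k a)) e)
          sum-from (zero , _ , e) with V.period a
          ... | suc p , _ , p≤n , pe = walkTo-sum n (σ a) b p (ℕₚ.<⇒≤ p≤n) (trans (sym (V.iter-suc p a)) (trans pe e))

    γ-step : ∀ {ψ} → VertexRule ψ → ∀ p c → Follows p c →
      red (γstep o (p , c)) ≡ (jumpF c ⊝ jumpF (α c) ⊕ ψ (σ⁻¹ c) ⊕ ψ c) ⊕ (⊝ ψ (α p) ⊝ ψ (σ⁻¹ (α p)))
    γ-step {ψ} rule p c pc = begin
      red (γstep o (p , c))
        ≡⟨ red-+ (b2z (o (inj₂ (α c))) ℤ.- b2z (o (inj₂ c))) (+ right ℤ.- + left) ⟩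
      red (b2z (o (inj₂ (α c))) ℤ.- b2z (o (inj₂ c))) ⊕ red (+ right ℤ.- + left)
        ≡⟨ cong₂ _⊕_ (trans (red-- (b2z (o (inj₂ (α c)))) (b2z (o (inj₂ c)))) (cong₂ _⊝_ (red-b2z (o (inj₂ (α c)))) (red-b2z (o (inj₂ c)))))
                     (red-- (+ right) (+ left)) ⟩
      ((1F ⊝ jumpF (α c)) ⊝ (1F ⊝ jumpF c)) ⊕ (redℕ right ⊝ redℕ left)
        ≡⟨ cong₂ (λ u v → ((1F ⊝ jumpF (α c)) ⊝ (1F ⊝ jumpF c)) ⊕ (u ⊝ v))
             (trans (redℕ-countB (λ x → not (o (inj₁ x))) (between (α p) c)) (between-sum (α p) c pc))
             (trans (redℕ-countB (λ x → not (o (inj₁ x))) (between c (α p))) (between-sum c (α p) (V.SO-sym (α p) c pc))) ⟩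
      ((1F ⊝ jumpF (α c)) ⊝ (1F ⊝ jumpF c)) ⊕ ((ψ (σ⁻¹ c) ⊝ ψ (α p)) ⊝ (ψ (σ⁻¹ (α p)) ⊝ ψ c))
        ≡⟨ identity 6 (λ u v a b e f → ((1F ⊝ u) ⊝ (1F ⊝ v)) ⊕ ((a ⊝ b) ⊝ (e ⊝ f)))
                      (λ u v a b e f → (v ⊝ u ⊕ a ⊕ f) ⊕ (⊝ b ⊝ e))
                      (jumpF (α c)) (jumpF c) (ψ (σ⁻¹ c)) (ψ (α p)) (ψ (σ⁻¹ (α p))) (ψ c) refl ⟩
      (jumpF c ⊝ jumpF (α c) ⊕ ψ (σ⁻¹ c) ⊕ ψ c) ⊕ (⊝ ψ (α p) ⊝ ψ (σ⁻¹ (α p))) ∎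
      where
        open AroundVertex rule
        right left : ℕ
        right = countB (λ x → not (o (inj₁ x))) (between (α p) c)
        left = countB (λ x → not (o (inj₁ x))) (between c (α p))
        red-b2z : ∀ b → red (b2z b) ≡ 1F ⊝ jump b
        red-b2z true = refl
        red-b2z false = refl

    γ-cycle : ∀ {ψ} → VertexRule ψ → ∀ w → IsCycle w → red (γ o w) ≡ ΣL (λ c → faceDefect ψ c ⊝ faceDefect ψ (α c)) w
    γ-cycle {ψ} rule _ ((x , xs , refl) , closed , _) = begin
      red (γ o (x ∷ xs))
        ≡⟨ red-sumL (γstep o) (cycPairs (x ∷ xs)) ⟩
      ΣL (λ pc → red (γstep o pc)) (cycPairs (x ∷ xs))
        ≡⟨ cyclic-sum-cong x xs closed (γ-step rule) ⟩
      ΣL (λ pc → G (proj₂ pc) ⊕ H (proj₁ pc)) (cycPairs (x ∷ xs))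
        ≡⟨ cyclic-sum G H x xs ⟩
      ΣL (λ c → G c ⊕ H c) (x ∷ xs)
        ≡⟨ ΣL-cong (x ∷ xs) G⊕H ⟩
      ΣL (λ c → faceDefect ψ c ⊝ faceDefect ψ (α c)) (x ∷ xs) ∎
      where
        G H : D → Z3
        G c = jumpF c ⊝ jumpF (α c) ⊕ ψ (σ⁻¹ c) ⊕ ψ c
        H p = ⊝ ψ (α p) ⊝ ψ (σ⁻¹ (α p))
        G⊕H : ∀ c → G c ⊕ H c ≡ faceDefect ψ c ⊝ faceDefect ψ (α c)
        G⊕H c = trans (identity 6 (λ f f' a b e h → (f ⊝ f' ⊕ a ⊕ b) ⊕ (⊝ e ⊝ h)) (λ f f' a b e h → (b ⊝ h ⊕ f) ⊝ (e ⊝ a ⊕ f'))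
                                  (jumpF c) (jumpF (α c)) (ψ (σ⁻¹ c)) (ψ c) (ψ (α c)) (ψ (σ⁻¹ (α c))) refl)
                      (cong (λ y → faceDefect ψ c ⊝ (ψ (α c) ⊝ ψ y ⊕ jumpF (α c))) (sym (cong σ⁻¹ (αα c))))

    module _ (k : ℕ) (B : Fin k → List D) (cycles : ∀ i → IsCycle (B i)) where

      -- Schnyder ⇒ mod-3 orientation with γ ≡ 0 on the basis: the labeling
      -- itself has no face defect.
      schnyder⇒mod3 : IsSchnyder o → IsMod3 o × (∀ i → (+ 3) ∣ γ o (B i))
      schnyder⇒mod3 schnyder with schnyder⇒rules schnyder
      ... | edgeVertices , ℓ , vertexRule , faceRule =
        (λ d → vertexRule⇒outPrimal {ℓ} vertexRule d , faceRule⇒outDual {ℓ} faceRule d , edgeVertices d) ,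
        (λ i → red≡0⇒3∣ (γ o (B i)) (trans (γ-cycle vertexRule (B i) (cycles i))
                                           (ΣL-zero _ (B i) (λ c → cong₂ _⊝_ (no-defect c) (no-defect (α c))))))
        where
          no-defect : ∀ c → faceDefect ℓ c ≡ 0F
          no-defect c = trans (cong (λ y → ℓ c ⊝ y ⊕ jumpF c) (faceRule c))
                              (identity 2 (λ a j → a ⊝ (a ⊕ j) ⊕ j) (λ _ _ → 0F) (ℓ c) (jumpF c) refl)

      -- Conversely, integrate: a vertex potential ψ from the primal
      -- vertices, then a correction t, constant on vertices, absorbing the
      -- face defect of ψ, which vanishes on closed walks by the homology
      -- argument.  The labeling ψ + t obeys both rules.
      mod3⇒schnyder : IsHomologyBasis k B → IsMod3 o → (∀ i → (+ 3) ∣ γ o (B i)) → IsSchnyder o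
      mod3⇒schnyder basis mod3 γ≡0 = rules⇒schnyder edgeVertices ℓ vertexRule faceRule
        where
          edgeVertices : EdgeVerticesOK
          edgeVertices d = proj₂ (proj₂ (mod3 d))
          potential : Σ (D → Z3) VertexRule
          potential = outPrimal⇒vertexRule (λ d → proj₁ (mod3 d))
          ψ : D → Z3
          ψ = proj₁ potential
          ψ-rule : VertexRule ψ
          ψ-rule = proj₂ potential
          K : D → Z3
          K = faceDefect ψ
          K-anti : ∀ d → K (α d) ≡ ⊝ K d
          K-anti = faceDefect-anti edgeVertices ψ-rule
          K-basis : ∀ i → ΣL (λ c → K c ⊕ K c) (B i) ≡ 0F
          K-basis i = trans (ΣL-cong (B i) (λ c → cong (K c ⊕_) (sym (trans (cong ⊝_ (K-anti c)) (⊝-involutive (K c))))))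
                            (trans (sym (γ-cycle ψ-rule (B i) (cycles i))) (3∣⇒red≡0 (γ o (B i)) (γ≡0 i)))
          K-closed : ∀ w → ClosedWalk w → ΣL K w ≡ 0F
          K-closed = Homology.closed-walks K K-anti (faceDefect-faces edgeVertices (λ d → proj₁ (proj₂ (mod3 d))) ψ-rule) k B basis K-basis
          correction : Σ (D → Z3) λ t → (∀ d → t (σ d) ≡ t d) × (∀ d → t (α d) ≡ t d ⊕ K d)
          correction = integrate K K-anti K-closed
          t : D → Z3
          t = proj₁ correction
          t-σ : ∀ d → t (σ d) ≡ t d
          t-σ = proj₁ (proj₂ correction)
          t-α : ∀ d → t (α d) ≡ t d ⊕ K d
          t-α = proj₂ (proj₂ correction)
          ℓ : Labeling
          ℓ d = ψ d ⊕ t d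
          vertexRule : VertexRule ℓ
          vertexRule d = begin
            ψ d ⊕ t d                            ≡⟨ cong₂ _⊕_ (ψ-rule d) (trans (cong t (sym (σσ⁻¹ d))) (t-σ (σ⁻¹ d))) ⟩
            ψ (σ⁻¹ d) ⊕ jumpV d ⊕ t (σ⁻¹ d)      ≡⟨ identity 3 (λ a j b → a ⊕ j ⊕ b) (λ a j b → a ⊕ b ⊕ j) (ψ (σ⁻¹ d)) (jumpV d) (t (σ⁻¹ d)) refl ⟩
            ψ (σ⁻¹ d) ⊕ t (σ⁻¹ d) ⊕ jumpV d      ∎
          faceRule : FaceRule ℓ
          faceRule d = begin
            ψ (σ⁻¹ (α d)) ⊕ t (σ⁻¹ (α d))        ≡⟨ cong (ψ (σ⁻¹ (α d)) ⊕_) (trans (sym (t-σ (σ⁻¹ (α d)))) (trans (cong t (σσ⁻¹ (α d))) (t-α d))) ⟩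
            ψ (σ⁻¹ (α d)) ⊕ (t d ⊕ K d)          ≡⟨ identity 4 (λ A a T j → A ⊕ (T ⊕ (a ⊝ A ⊕ j))) (λ A a T j → a ⊕ T ⊕ j) (ψ (σ⁻¹ (α d))) (ψ d) (t d) (jumpF d) refl ⟩
            ψ d ⊕ t d ⊕ jumpF d                  ∎

theorem24 : {n : ℕ} (M : Map n) (g : ℕ) →
    let open MapDefs M in
    NoShortContractibleCycles →
    numV + numF + 2 * g ≡ numE + 2 →
    (B : Fin (2 * g) → List (Fin n)) →
    (∀ i → IsCycle (B i)) →
    IsHomologyBasis (2 * g) B →
    (o : Orientation) →
    IsSchnyder o ⇔ (IsMod3 o × (∀ i → (+ 3) ∣ γ o (B i)))
theorem24 M g _ _ B cycles basis o =
  mk⇔ (schnyder⇒mod3 (2 * g) B cycles)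
      (λ (mod3 , γ≡0) → mod3⇒schnyder (2 * g) B cycles basis mod3 γ≡0)
  where open OnMap.WithOrientation M o
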